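{- Let $k \ge 2$ be an integer. If $k = 2$, let $C$ be the multigraph consisting of two vertices $v_0, v_1$ joined by two parallel edges; if $k \ge 3$, let $C$ be the cycle $v_0 v_1 \ldots v_{k-1} v_0$. For each $i \in \{0, \ldots, k-1\}$ let $H_i$ be a HIST-critical $\{x_i, y_i\}$-fragment, where the graphs $H_0, \ldots, H_{k-1}$ are pairwise disjoint and disjoint from $C$. For every $i$ (indices mod $k$), identify $v_i$ with $x_i$ and $v_{i+1}$ with $y_i$, and remove (one copy of) the edge $v_i v_{i+1}$; thus all edges of $C$ are removed and the resulting graph $G$ is obtained from the disjoint union of $H_0, \ldots, H_{k-1}$ by identifying $y_i$ with $x_{i+1}$ for every $i$ (indices mod $k$). Then $G$ is HIST-critical.
   Context: A HIST of a graph is a spanning tree with no vertex of degree $2$. A graph is HIST-free if it contains no HIST, and HIST-critical if it is HIST-free and $G - v$ contains a HIST for every vertex $v$. For a tree or forest $\Upsilon$, $d_\Upsilon(v)$ denotes the degree of $v$ in $\Upsilon$. Let $F$ be a graph with vertex set $\{x, y, v_1, \ldots, v_\ell\}$, $\ell \ge 1$, $x \ne y$. For a subgraph $H$ of $F$, a spanning tree (resp. spanning forest) $\Upsilon$ of $H$ is an $\{x,y\}$-excluded HIST (resp. $\{x,y\}$-excluded HISF) of $H$ if $d_\Upsilon(v) \ne 2$ for all $v \in V(H) \setminus \{x,y\}$. $F$ is a HIST-critical $\{x,y\}$-fragment if all of the following hold: (1) $F$ has an $\{x,y\}$-excluded HIST, and every $\{x,y\}$-excluded HIST $T$ of $F$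 satisfies $d_T(x) = d_T(y) = 2$; (2) $F - x$ has an $\{x,y\}$-excluded HIST $T$ with $d_T(y) \ne 1$, and $F - y$ has an $\{x,y\}$-excluded HIST $T$ with $d_T(x) \ne 1$; (3) for every $v \in V(F) \setminus \{x,y\}$, the graph $F - v$ has either (a) an $\{x,y\}$-excluded HIST $T$ with $d_T(x) \ne 2$ or $d_T(y) \ne 2$, or (b) an $\{x,y\}$-excluded HISF consisting of exactly two components $T_x$ and $T_y$, each with at least two vertices, such that $x \in V(T_x)$ and $y \in V(T_y)$; (4) $F$ itself has no $\{x,y\}$-excluded HISF consisting of exactly two components $T_x, T_y$, each with at least two vertices, with $x \in V(T_x)$ and $y \in V(T_y)$. -}

module Defs where

open import Data.Nat using (ℕ; zero; suc; _≤_)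
open import Data.Nat.DivMod using (_mod_)
open import Data.Fin using (Fin; toℕ; _≟_)
open import Data.Bool using (Bool; true; false; not; _∧_; _∨_; if_then_else_)
open import Data.List using (List; map; allFin)
open import Data.Nat.ListAction using (sum)
open import Data.Product using (Σ; ∃; _×_; _,_)
open import Data.Sum using (_⊎_)
open import Data.Empty using (⊥)
open import Relation.Nullary using (¬_; does)
open import Relation.Binary.PropositionalEquality using (_≡_; _≢_)
open import Relation.Binary.Construct.Closure.ReflexiveTransitive using (Star)

record Graph (n : ℕ) : Set where
  field
    adj      : Fin n → Fin n → Bool
    sym      : ∀ u v → adj u v ≡ adj v u
    loopless : ∀ v → adj v v ≡ false
open Graph public

EdgeSet : ℕ → Set
EdgeSet n = Fin n → Fin n → Bool

Edge : ∀ {n} → EdgeSet n → Fin n → Fin n → Set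
Edge T u v = T u v ≡ true

Conn : ∀ {n} → EdgeSet n → Fin n → Fin n → Set
Conn T = Star (Edge T)

deleteEdge : ∀ {n} → EdgeSet n → Fin n → Fin n → EdgeSet n
deleteEdge T u v a b =
  T a b ∧ not ((does (a ≟ u) ∧ does (b ≟ v)) ∨ (does (a ≟ v) ∧ does (b ≟ u)))

Acyclic : ∀ {n} → EdgeSet n → Set
Acyclic T = ∀ u v → Edge T u v → ¬ Conn (deleteEdge T u v) u v

deg : ∀ {n} → EdgeSet n → Fin n → ℕ
deg {n} T v = sum (map (λ w → if T v w then 1 else 0) (allFin n))

-- Vertex subsets (the vertex set of the subgraph G[S] under consideration).
VSet : ℕ → Set
VSet n = Fin n → Bool

full : ∀ {n} → VSet n
full _ = true

minus : ∀ {n} → Fin n → VSet n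
minus v w = not (does (w ≟ v))

IsSpanningForest : ∀ {n} → Graph n → VSet n → EdgeSet n → Set
IsSpanningForest G S T =
  (∀ u v → T u v ≡ T v u) ×
  (∀ u v → Edge T u v → Edge (adj G) u v × S u ≡ true × S v ≡ true) ×
  Acyclic T

IsSpanningTree : ∀ {n} → Graph n → VSet n → EdgeSet n → Set
IsSpanningTree G S T =
  IsSpanningForest G S T ×
  (∀ u v → S u ≡ true → S v ≡ true → Conn T u v)

IsExclHIST : ∀ {n} → Graph n → VSet n → (Fin n → Set) → EdgeSet n → Set
IsExclHIST G S X T =
  IsSpanningTree G S T × (∀ v → S v ≡ true → ¬ X v → deg T v ≢ 2)

NoExcl : ∀ {n} → Fin n → Set
NoExcl _ = ⊥

Pair : ∀ {n} → Fin n → Fin n → Fin n → Set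
Pair x y v = v ≡ x ⊎ v ≡ y

IsHIST : ∀ {n} → Graph n → VSet n → EdgeSet n → Set
IsHIST G S T = IsExclHIST G S NoExcl T

IsTwoCompHISF : ∀ {n} → Graph n → VSet n → Fin n → Fin n → EdgeSet n → Set
IsTwoCompHISF G S x y T =
  IsSpanningForest G S T ×
  (∀ v → S v ≡ true → ¬ Pair x y v → deg T v ≢ 2) ×
  ¬ Conn T x y ×
  (∀ v → S v ≡ true → Conn T x v ⊎ Conn T y v) ×
  (∃ λ w → Edge T x w) ×
  (∃ λ w → Edge T y w)

IsHISTCritical : ∀ {n} → Graph n → Set
IsHISTCritical G =
  ¬ (∃ λ T → IsHIST G full T) ×
  (∀ v → ∃ λ T → IsHIST G (minus v) T)

-- HIST-critical {x,y}-fragment (vertex set {x,y,v_1..v_ℓ}, ℓ ≥ 1).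
IsHISTCriticalFragment : ∀ {n} → Graph n → Fin n → Fin n → Set
IsHISTCriticalFragment {n} F x y =
  3 ≤ n × x ≢ y ×
  -- (1)
  ((∃ λ T → IsExclHIST F full (Pair x y) T) ×
   (∀ T → IsExclHIST F full (Pair x y) T → deg T x ≡ 2 × deg T y ≡ 2)) ×
  -- (2)
  ((∃ λ T → IsExclHIST F (minus x) (Pair x y) T × deg T y ≢ 1) ×
   (∃ λ T → IsExclHIST F (minus y) (Pair x y) T × deg T x ≢ 1)) ×
  -- (3)
  (∀ v → v ≢ x → v ≢ y →
     (∃ λ T → IsExclHIST F (minus v) (Pair x y) T × (deg T x ≢ 2 ⊎ deg T y ≢ 2))
     ⊎ (∃ λ T → IsTwoCompHISF F (minus v) x y T)) ×
  -- (4)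
  ¬ (∃ λ T → IsTwoCompHISF F full x y T)

next : ∀ {k} → Fin k → Fin k
next {suc m} i = suc (toℕ i) mod suc m

Glued : ∀ {k} {n : Fin k → ℕ} (x y : (i : Fin k) → Fin (n i)) →
        Σ (Fin k) (λ i → Fin (n i)) → Σ (Fin k) (λ i → Fin (n i)) → Set
Glued x y p q = ∃ λ i → p ≡ (i , y i) × q ≡ (next i , x (next i))

-- G (on Fin N) together with φ : ⊔ᵢ V(Hᵢ) → V(G) is (up to isomorphism) the
-- graph obtained from the disjoint union of the Hᵢ by identifying yᵢ with x_{i+1}:
-- φ identifies exactly the glued pairs, is onto, and the edges of G are exactly
-- the images of edges of the Hᵢ.
IsCyclicGluing : ∀ {k N} (n : Fin k → ℕ) (H : (i : Fin k) → Graph (n i))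
                 (x y : (i : Fin k) → Fin (n i)) (G : Graph N)
                 (φ : Σ (Fin k) (λ i → Fin (n i)) → Fin N) → Set
IsCyclicGluing n H x y G φ =
  (∀ i → φ (i , y i) ≡ φ (next i , x (next i))) ×
  (∀ p q → φ p ≡ φ q → p ≡ q ⊎ Glued x y p q ⊎ Glued x y q p) ×
  (∀ a → ∃ λ p → φ p ≡ a) ×
  (∀ a b → Edge (adj G) a b →
     ∃ λ i → ∃ λ u → ∃ λ w → Edge (adj (H i)) u w × φ (i , u) ≡ a × φ (i , w) ≡ b) ×
  (∀ i u w → Edge (adj (H i)) u w → Edge (adj G) (φ (i , u)) (φ (i , w)))

-- Let T be a HIST of G. Its edges inside H_i form a forest T_i in which every vertex hangs from
-- x_i or y_i; inner vertices keep their T-degree, and the T-degree of a junction y_i = x_{i+1} is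
-- the sum of its degrees in T_i and T_{i+1}. If x_i and y_i both have neighbours in T_i, then by
-- (4) T_i joins them, so by (1) both have degree 2 and, by (4) again, x_i y_i is not an edge of T_i.
-- Hence an isolated x_{i+1} forces an isolated x_i and an isolated y_i an isolated y_{i+1}; all
-- x_i (or all y_i) isolated disconnects T, and otherwise the x_i–y_i paths of the T_i close a cycle.
--
-- Conversely, G − v has a HIST: cut the cycle at a junction next to v and glue excluded HISTs of
-- the fragments along the remaining junctions, using (2) on both sides of a junction v, the tree
-- of (3a) on the fragment of an inner vertex v (placed so that its end of degree ≠ 2 is at the
-- cut), and (1) elsewhere. Every remaining junction gets degree at least 3, as one side has degree
-- ≠ 1. In case (3b) the two components of the forest of H_j − v open the cycle at x_j instead.

module Submission where

open import Defs hiding (sym)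
open import Data.Nat using (ℕ; zero; suc; _+_; _≤_; _<_; z≤n; s≤s; s≤s⁻¹; _∸_; _%_)
open import Data.Nat.Properties
  using (suc-injective; +-assoc; +-suc; 1+n≢0; m+1+n≢0; ≤-refl; m≤n⇒m≤1+n; m≤n⇒m<n∨m≡n; <⇒≤;
         +-identityʳ; +-comm; m+[n∸m]≡n; _<?_; <⇒≢; +-cancelˡ-≡; <-irrefl; +-cancelʳ-<; m∸n+n≡m;
         +-monoʳ-<; ≮⇒≥; +-mono-<; m<n⇒0<n∸m; ≤-trans; m∸n≤m; n≤0⇒n≡0; +-cancelʳ-≤; 1+n≰n)
open import Data.Nat.DivMod
  using (m%n<n; m%n%n≡m%n; [m+n]%n≡m%n; m<n⇒m%n≡m; %-distribˡ-+; m≤n⇒[n∸m]%m≡n%m)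
open import Data.Nat.ListAction using (sum)
open import Data.Fin using (Fin; zero; suc; _≟_; splitAt; join; toℕ)
open import Data.Fin.Properties
  using (any?; 0≢1+n; splitAt-join; join-splitAt; toℕ-fromℕ<; toℕ-injective; toℕ<n; all?; ¬∀⟶∃¬)
  renaming (suc-injective to suc-injectiveᶠ)
open import Data.Bool using (Bool; true; false; not; _∧_; _∨_; if_then_else_)
open import Data.Bool.Properties
  using (∧-conicalˡ; ∧-conicalʳ; ∧-identityʳ; ∧-zeroʳ; ∨-conicalˡ; ∨-conicalʳ; ∨-comm)
  renaming (_≟_ to _≟ᵇ_)
open import Data.List using (tabulate)
open import Data.List.Properties using (map-tabulate)
open import Data.Product using (∃; _×_; _,_; proj₁; proj₂; Σ)
open import Data.Product.Properties using (,-injectiveˡ; ,-injectiveʳ-UIP)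
open import Data.Sum using (_⊎_; inj₁; inj₂; [_,_]; [_,_]′; swap) renaming (map to ⊎-map)
open import Data.Sum.Properties using ([,]-map)
open import Data.Empty using (⊥; ⊥-elim)
open import Function using (_∘_; id; _∋_)
open import Function.Definitions using (Injective)
open import Relation.Nullary using (¬_; Dec; yes; no; does)
open import Relation.Nullary.Decidable using (dec-true; dec-false; _×-dec_)
open import Relation.Binary.PropositionalEquality
  using (_≡_; _≢_; refl; sym; trans; cong; cong₂; subst; subst₂; module ≡-Reasoning)
open import Relation.Binary.Construct.Closure.ReflexiveTransitive as Star using (ε; _◅_; _◅◅_)
open import Axiom.UniquenessOfIdentityProofs using (module Decidable⇒UIP)
true-or-false : (b : Bool) → b ≡ true ⊎ b ≡ false
true-or-false true = inj₁ refl
true-or-false false = inj₂ refl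

true⇒≢false : ∀ {b} → b ≡ true → b ≢ false
true⇒≢false refl ()

∧-true : ∀ {a b} → a ≡ true → b ≡ true → a ∧ b ≡ true
∧-true refl refl = refl

∨-true⁻ : ∀ {a b} → a ∨ b ≡ true → a ≡ true ⊎ b ≡ true
∨-true⁻ {true} _ = inj₁ refl
∨-true⁻ {false} e = inj₂ e

∨-trueˡ : ∀ {a} b → a ≡ true → a ∨ b ≡ true
∨-trueˡ b refl = refl

∨-trueʳ : ∀ a {b} → b ≡ true → a ∨ b ≡ true
∨-trueʳ true _ = refl
∨-trueʳ false e = e

not-true⁻ : ∀ {b} → not b ≡ true → b ≡ false
not-true⁻ {false} _ = refl

bool-ext : ∀ {a b : Bool} → (a ≡ true → b ≡ true) → (b ≡ true → a ≡ true) → a ≡ b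
bool-ext {true} f _ = sym (f refl)
bool-ext {false} {false} _ _ = refl
bool-ext {false} {true} _ g = g refl

does-true⁻ : ∀ {ℓ} {A : Set ℓ} (d : Dec A) → does d ≡ true → A
does-true⁻ (yes a) _ = a

¬true⇒false : ∀ {b} → b ≢ true → b ≡ false
¬true⇒false {true} ¬t = ⊥-elim (¬t refl)
¬true⇒false {false} _ = refl

¬false⇒true : ∀ {b} → b ≢ false → b ≡ true
¬false⇒true {true} _ = refl
¬false⇒true {false} ¬f = ⊥-elim (¬f refl)

¬¬-∀-Fin : ∀ {n ℓ} {P : Fin n → Set ℓ} → (∀ i → ¬ ¬ P i) → ¬ ¬ (∀ i → P i)
¬¬-∀-Fin {zero} _ k = k (λ ())
¬¬-∀-Fin {suc n} h k = h zero λ p₀ → ¬¬-∀-Fin (h ∘ suc) λ ps → k λ { zero → p₀ ; (suc i) → ps i }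

_[_≔_] : ∀ {K ℓ} {C : Fin K → Set ℓ} → ((i : Fin K) → C i) → (j : Fin K) → C j → (i : Fin K) → C i
(f [ j ≔ c ]) i with j ≟ i
... | yes refl = c
... | no _ = f i

update-same : ∀ {K ℓ} {C : Fin K → Set ℓ} (f : (i : Fin K) → C i) j c → (f [ j ≔ c ]) j ≡ c
update-same f j c with j ≟ j
... | yes refl = refl
... | no j≢j = ⊥-elim (j≢j refl)

update-other : ∀ {K ℓ} {C : Fin K → Set ℓ} (f : (i : Fin K) → C i) j c {i} → j ≢ i → (f [ j ≔ c ]) i ≡ f i
update-other f j c {i} j≢i with j ≟ i
... | yes j≡i = ⊥-elim (j≢i j≡i)
... | no _ = refl

minus-true : ∀ {n} {z w : Fin n} → w ≢ z → minus z w ≡ true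
minus-true {z = z} {w} w≢z = cong not (dec-false (w ≟ z) w≢z)

minus-true⁻ : ∀ {n} {z w : Fin n} → minus z w ≡ true → w ≢ z
minus-true⁻ {z = z} {w} e w≡z = true⇒≢false e (cong not (dec-true (w ≟ z) w≡z))

minus-self : ∀ {n} (z : Fin n) → minus z z ≡ false
minus-self z = cong not (dec-true (z ≟ z) refl)

minus-false⁻ : ∀ {n} {z w : Fin n} → minus z w ≡ false → w ≡ z
minus-false⁻ {z = z} {w} e with w ≟ z
... | yes w≡z = w≡z

-- Counting and degrees

count : ∀ {n} → (Fin n → Bool) → ℕ
count {zero} p = 0
count {suc n} p = (if p zero then 1 else 0) + count (p ∘ suc)

deg≡count : ∀ {n} (T : EdgeSet n) v → deg T v ≡ count (T v)
deg≡count {n} T v = trans (cong sum (map-tabulate id (λ w → if T v w then 1 else 0))) (go (T v))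
  where
  go : ∀ {m} (p : Fin m → Bool) → sum (tabulate (λ w → if p w then 1 else 0)) ≡ count p
  go {zero} p = refl
  go {suc m} p = cong ((if p zero then 1 else 0) +_) (go (p ∘ suc))

count-cong : ∀ {n} {p q : Fin n → Bool} → (∀ i → p i ≡ q i) → count p ≡ count q
count-cong {zero} _ = refl
count-cong {suc n} h = cong₂ _+_ (cong (λ b → if b then 1 else 0) (h zero)) (count-cong (h ∘ suc))

count-none : ∀ {n} {p : Fin n → Bool} → (∀ i → p i ≡ false) → count p ≡ 0
count-none {zero} _ = refl
count-none {suc n} h rewrite h zero = count-none (h ∘ suc)

_∖_ : ∀ {n} → (Fin n → Bool) → Fin n → Fin n → Bool
(p ∖ a) i = p i ∧ not (does (i ≟ a))

∖-true : ∀ {n} (p : Fin n → Bool) {a i} → p i ≡ true → i ≢ a → (p ∖ a) i ≡ true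
∖-true p {a} {i} pi i≢a = ∧-true pi (cong not (dec-false (i ≟ a) i≢a))

∖-true⁻ : ∀ {n} (p : Fin n → Bool) {a i} → (p ∖ a) i ≡ true → p i ≡ true × i ≢ a
∖-true⁻ p {a} {i} e =
  ∧-conicalˡ _ _ e , λ i≡a → true⇒≢false (∧-conicalʳ (p i) _ e) (cong not (dec-true (i ≟ a) i≡a))

count-remove : ∀ {n} (p : Fin n → Bool) {a} → p a ≡ true → count p ≡ suc (count (p ∖ a))
count-remove {suc n} p {zero} pa rewrite pa =
  cong suc (count-cong λ i → sym (∧-identityʳ (p (suc i))))
count-remove {suc n} p {suc a} pa =
  trans (cong ((if p zero then 1 else 0) +_) (count-remove (p ∘ suc) pa))
        (trans (+-suc _ _)
               (cong (λ b → suc ((if b then 1 else 0) + count ((p ∘ suc) ∖ a))) (sym (∧-identityʳ (p zero)))))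

count≢0 : ∀ {n} (p : Fin n → Bool) {a} → p a ≡ true → count p ≢ 0
count≢0 p pa e = 1+n≢0 (trans (sym (count-remove p pa)) e)

count≢0⇒witness : ∀ {n} (p : Fin n → Bool) → count p ≢ 0 → ∃ λ a → p a ≡ true
count≢0⇒witness p c≢0 with any? (λ a → p a ≟ᵇ true)
... | yes w = w
... | no ¬w = ⊥-elim (c≢0 (count-none λ a → ¬true⇒false λ pa → ¬w (a , pa)))

count≡2⇒other : ∀ {n} (p : Fin n → Bool) → count p ≡ 2 → ∀ c → ∃ λ a → p a ≡ true × a ≢ c
count≡2⇒other p c2 c = witness (count≢0⇒witness (p ∖ c) rest≢0)
  where
  witness : (∃ λ a → (p ∖ c) a ≡ true) → ∃ λ a → p a ≡ true × a ≢ c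
  witness (a , e) = a , ∖-true⁻ p e
  rest≢0 : count (p ∖ c) ≢ 0
  rest≢0 with true-or-false (p c)
  ... | inj₁ pc = λ e → 1+n≢0 (suc-injective (trans (sym c2) (trans (count-remove p pc) (cong suc e))))
  ... | inj₂ pc = λ e → 1+n≢0 (trans (sym c2) (trans (count-cong (λ i → sym (same i))) e))
    where
    same : ∀ i → (p ∖ c) i ≡ p i
    same i with i ≟ c
    ... | yes refl = trans (∧-zeroʳ _) (sym pc)
    ... | no _ = ∧-identityʳ (p i)

InjectiveOn : ∀ {n N} → (Fin n → Bool) → (Fin n → Fin N) → Set
InjectiveOn r f = ∀ {w w'} → r w ≡ true → r w' ≡ true → f w ≡ f w' → w ≡ w'

IsImage : ∀ {n N} → (Fin n → Fin N) → (Fin n → Bool) → (Fin N → Bool) → Set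
IsImage f r q = (∀ w → r w ≡ true → q (f w) ≡ true) × (∀ b → q b ≡ true → ∃ λ w → r w ≡ true × f w ≡ b)

count-image : ∀ {n N} {r : Fin n → Bool} {q : Fin N → Bool} (f : Fin n → Fin N) →
              InjectiveOn r f → IsImage f r q → count q ≡ count r
count-image {zero} f _ (_ , onto) = count-none λ b → ¬true⇒false λ qb → empty (onto b qb)
  where
  empty : ∀ {ℓ} {P : Fin 0 → Set ℓ} → ∃ P → ⊥
  empty (() , _)
count-image {suc n} {r = r} {q} f inj (into , onto) with true-or-false (r zero)
... | inj₁ r0 rewrite r0 =
  trans (count-remove q (into zero r0))
        (cong suc (count-image (f ∘ suc) (λ rw rw' e → suc-injectiveᶠ (inj rw rw' e)) (into' , onto')))
  where
  into' : ∀ w → r (suc w) ≡ true → (q ∖ f zero) (f (suc w)) ≡ true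
  into' w rw = ∖-true q (into (suc w) rw) (λ e → 0≢1+n (sym (inj rw r0 e)))
  onto' : ∀ b → (q ∖ f zero) b ≡ true → ∃ λ w → r (suc w) ≡ true × f (suc w) ≡ b
  onto' b e with ∖-true⁻ q e
  ... | qb , b≢f0 with onto b qb
  ...   | zero , _ , f0≡b = ⊥-elim (b≢f0 (sym f0≡b))
  ...   | suc w , rw , fw≡b = w , rw , fw≡b
... | inj₂ r0 rewrite r0 = count-image (f ∘ suc) (λ rw rw' e → suc-injectiveᶠ (inj rw rw' e)) (into ∘ suc , onto')
  where
  onto' : ∀ b → q b ≡ true → ∃ λ w → r (suc w) ≡ true × f (suc w) ≡ b
  onto' b qb with onto b qb
  ... | zero , r0' , _ = ⊥-elim (true⇒≢false r0' r0)
  ... | suc w , rw , fw≡b = w , rw , fw≡b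

count-splitAt : ∀ {n₁ n₂} (r₁ : Fin n₁ → Bool) (r₂ : Fin n₂ → Bool) →
                count ([ r₁ , r₂ ]′ ∘ splitAt n₁) ≡ count r₁ + count r₂
count-splitAt {zero} r₁ r₂ = refl
count-splitAt {suc n₁} r₁ r₂ =
  trans (cong ((if r₁ zero then 1 else 0) +_)
              (trans (count-cong λ i → [,]-map (splitAt n₁ i)) (count-splitAt (r₁ ∘ suc) r₂)))
        (sym (+-assoc (if r₁ zero then 1 else 0) (count (r₁ ∘ suc)) (count r₂)))

count-image₂ : ∀ {n₁ n₂ N} {r₁ : Fin n₁ → Bool} {r₂ : Fin n₂ → Bool} {q : Fin N → Bool}
               (f₁ : Fin n₁ → Fin N) (f₂ : Fin n₂ → Fin N) →
               InjectiveOn r₁ f₁ → InjectiveOn r₂ f₂ →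
               (∀ {w₁ w₂} → r₁ w₁ ≡ true → r₂ w₂ ≡ true → f₁ w₁ ≢ f₂ w₂) →
               (∀ w → r₁ w ≡ true → q (f₁ w) ≡ true) → (∀ w → r₂ w ≡ true → q (f₂ w) ≡ true) →
               (∀ b → q b ≡ true → (∃ λ w → r₁ w ≡ true × f₁ w ≡ b) ⊎ (∃ λ w → r₂ w ≡ true × f₂ w ≡ b)) →
               count q ≡ count r₁ + count r₂
count-image₂ {n₁} {n₂} {N} {r₁} {r₂} {q} f₁ f₂ inj₁' inj₂' disjoint into₁ into₂ onto =
  trans (count-image f inj (into , onto')) (count-splitAt r₁ r₂)
  where
  f : Fin (n₁ + n₂) → Fin N
  f = [ f₁ , f₂ ]′ ∘ splitAt n₁
  r : Fin (n₁ + n₂) → Bool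
  r = [ r₁ , r₂ ]′ ∘ splitAt n₁
  splitAt-injective : ∀ {i j} → splitAt n₁ i ≡ splitAt n₁ j → i ≡ j
  splitAt-injective {i} {j} e =
    trans (sym (join-splitAt n₁ n₂ i)) (trans (cong (join n₁ n₂) e) (join-splitAt n₁ n₂ j))
  inj : InjectiveOn r f
  inj {i} {i'} ri ri' e with splitAt n₁ i in eq | splitAt n₁ i' in eq'
  ... | inj₁ a | inj₁ a' = splitAt-injective (trans eq (trans (cong inj₁ (inj₁' ri ri' e)) (sym eq')))
  ... | inj₂ a | inj₂ a' = splitAt-injective (trans eq (trans (cong inj₂ (inj₂' ri ri' e)) (sym eq')))
  ... | inj₁ a | inj₂ a' = ⊥-elim (disjoint ri ri' e)
  ... | inj₂ a | inj₁ a' = ⊥-elim (disjoint ri' ri (sym e))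
  into : ∀ i → r i ≡ true → q (f i) ≡ true
  into i ri with splitAt n₁ i
  ... | inj₁ a = into₁ a ri
  ... | inj₂ a = into₂ a ri
  from : ∀ {b} s → [ r₁ , r₂ ]′ s ≡ true → [ f₁ , f₂ ]′ s ≡ b → ∃ λ i → r i ≡ true × f i ≡ b
  from s rs fs rewrite sym (splitAt-join n₁ n₂ s) = join n₁ n₂ s , rs , fs
  onto' : ∀ b → q b ≡ true → ∃ λ i → r i ≡ true × f i ≡ b
  onto' b qb with onto b qb
  ... | inj₁ (w , rw , e) = from (inj₁ w) rw e
  ... | inj₂ (w , rw , e) = from (inj₂ w) rw e

deg-none : ∀ {n} {T : EdgeSet n} {v} → (∀ w → T v w ≡ false) → deg T v ≡ 0
deg-none {T = T} {v} none = trans (deg≡count T v) (count-none none)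

deg≢0 : ∀ {n} {T : EdgeSet n} {v w} → Edge T v w → deg T v ≢ 0
deg≢0 {T = T} {v} e d = count≢0 (T v) e (trans (sym (deg≡count T v)) d)

deg-cong : ∀ {n} {T T' : EdgeSet n} {v} → (∀ w → T v w ≡ T' v w) → deg T v ≡ deg T' v
deg-cong {T = T} {T'} {v} h = trans (deg≡count T v) (trans (count-cong h) (sym (deg≡count T' v)))

+≢2 : ∀ {a b} → a ≢ 0 → b ≢ 0 → a ≢ 1 ⊎ b ≢ 1 → a + b ≢ 2
+≢2 {zero} a≢0 _ _ = ⊥-elim (a≢0 refl)
+≢2 {suc zero} {zero} _ b≢0 _ = ⊥-elim (b≢0 refl)
+≢2 {suc zero} {suc zero} _ _ (inj₁ a≢1) _ = a≢1 refl
+≢2 {suc zero} {suc zero} _ _ (inj₂ b≢1) _ = b≢1 refl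
+≢2 {suc zero} {suc (suc b)} _ _ _ ()
+≢2 {suc (suc a)} {zero} _ b≢0 _ = ⊥-elim (b≢0 refl)
+≢2 {suc (suc a)} {suc b} _ _ _ e = m+1+n≢0 a (suc-injective (suc-injective e))

≡2⇒≢1 : ∀ {a} → a ≡ 2 → a ≢ 1
≡2⇒≢1 refl ()

≡0⇒≢2 : ∀ {a} → a ≡ 0 → a ≢ 2
≡0⇒≢2 refl ()

≡2⇒≢0 : ∀ {a} → a ≡ 2 → a ≢ 0
≡2⇒≢0 refl ()

-- Walks and spanning trees

Undirected : ∀ {n} → EdgeSet n → Set
Undirected T = ∀ u v → T u v ≡ T v u

_⊆ₑ_ : ∀ {n} → EdgeSet n → EdgeSet n → Set
A ⊆ₑ B = ∀ {a b} → Edge A a b → Edge B a b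

edge-sym : ∀ {n} {T : EdgeSet n} → Undirected T → ∀ {a b} → Edge T a b → Edge T b a
edge-sym und {a} {b} e = trans (und b a) e

walk-reverse : ∀ {n} {T : EdgeSet n} → Undirected T → ∀ {a b} → Conn T a b → Conn T b a
walk-reverse und = Star.reverse (edge-sym und)

walk-subst : ∀ {n} {T : EdgeSet n} {a b a' b'} → a ≡ a' → b ≡ b' → Conn T a b → Conn T a' b'
walk-subst refl refl w = w

deleteEdge⁺ : ∀ {n} {T : EdgeSet n} {u v a b} → Edge T a b →
              ¬ (a ≡ u × b ≡ v) → ¬ (a ≡ v × b ≡ u) → Edge (deleteEdge T u v) a b
deleteEdge⁺ {u = u} {v} {a} {b} e ¬uv ¬vu with a ≟ u | b ≟ v | a ≟ v | b ≟ u
... | yes p | yes q | _     | _     = ⊥-elim (¬uv (p , q))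
... | _     | _     | yes p | yes q = ⊥-elim (¬vu (p , q))
... | no _  | _     | no _  | _     = ∧-true e refl
... | no _  | _     | yes _ | no _  = ∧-true e refl
... | yes _ | no _  | no _  | _     = ∧-true e refl
... | yes _ | no _  | yes _ | no _  = ∧-true e refl

deleteEdge⁻ : ∀ {n} {T : EdgeSet n} {u v a b} → Edge (deleteEdge T u v) a b →
              Edge T a b × ¬ (a ≡ u × b ≡ v) × ¬ (a ≡ v × b ≡ u)
deleteEdge⁻ {T = T} {u} {v} {a} {b} e = ∧-conicalˡ _ _ e , ¬uv , ¬vu
  where
  kept : (does (a ≟ u) ∧ does (b ≟ v)) ∨ (does (a ≟ v) ∧ does (b ≟ u)) ≡ false
  kept = not-true⁻ (∧-conicalʳ (T a b) _ e)
  ¬uv : ¬ (a ≡ u × b ≡ v)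
  ¬uv (refl , refl) =
    true⇒≢false (∧-true (dec-true (a ≟ a) refl) (dec-true (b ≟ b) refl)) (∨-conicalˡ _ _ kept)
  ¬vu : ¬ (a ≡ v × b ≡ u)
  ¬vu (refl , refl) =
    true⇒≢false (∧-true (dec-true (a ≟ a) refl) (dec-true (b ≟ b) refl)) (∨-conicalʳ _ _ kept)

deleteEdge-mono : ∀ {n} {A B : EdgeSet n} {u v} → A ⊆ₑ B → deleteEdge A u v ⊆ₑ deleteEdge B u v
deleteEdge-mono {A = A} {B} {u} {v} A⊆B e with deleteEdge⁻ {T = A} {u} {v} e
... | e' , ¬uv , ¬vu = deleteEdge⁺ {T = B} {u} {v} (A⊆B e') ¬uv ¬vu

deleteEdge-undirected : ∀ {n} {T : EdgeSet n} {u v} → Undirected T → Undirected (deleteEdge T u v)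
deleteEdge-undirected {T = T} {u} {v} und a b = bool-ext (flip a b) (flip b a)
  where
  flip : ∀ a b → Edge (deleteEdge T u v) a b → Edge (deleteEdge T u v) b a
  flip a b e with deleteEdge⁻ {T = T} {u} {v} e
  ... | e' , ¬uv , ¬vu =
    deleteEdge⁺ {T = T} {u} {v} (edge-sym {T = T} und e') (λ (p , q) → ¬vu (q , p)) (λ (p , q) → ¬uv (q , p))

Acyclic-mono : ∀ {n} {A B : EdgeSet n} → A ⊆ₑ B → Acyclic B → Acyclic A
Acyclic-mono {A = A} {B} A⊆B acyclic u v e w =
  acyclic u v (A⊆B e) (Star.map (deleteEdge-mono {A = A} {B} {u} {v} A⊆B) w)

walk-split : ∀ {n} (T : EdgeSet n) (p q : Fin n) {c v} → Conn T c v →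
             Conn (deleteEdge T p q) c v ⊎ Conn (deleteEdge T p q) c p ⊎ Conn (deleteEdge T p q) c q
walk-split T p q ε = inj₁ ε
walk-split T p q (_◅_ {i = c} {j = c'} e w) with c ≟ p | c ≟ q
... | yes refl | _ = inj₂ (inj₁ ε)
... | no _ | yes refl = inj₂ (inj₂ ε)
... | no c≢p | no c≢q = ⊎-map (kept ◅_) (⊎-map (kept ◅_) (kept ◅_)) (walk-split T p q w)
  where
  kept : Edge (deleteEdge T p q) c c'
  kept = deleteEdge⁺ {T = T} {p} {q} e (c≢p ∘ proj₁) (c≢q ∘ proj₁)

avoiding : ∀ {n} → EdgeSet n → Fin n → EdgeSet n
avoiding T u a b = T a b ∧ (minus u a ∧ minus u b)

last-exit : ∀ {n} (T : EdgeSet n) {u v} → Conn T u v → u ≢ v →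
            ∃ λ a → Edge T u a × Conn (avoiding T u) a v
last-exit T {u} w u≢v with go w (u≢v ∘ sym)
  where
  go : ∀ {c v} → Conn T c v → v ≢ u →
       (Conn (avoiding T u) c v × c ≢ u) ⊎ (∃ λ a → Edge T u a × Conn (avoiding T u) a v)
  go ε v≢u = inj₁ (ε , v≢u)
  go (_◅_ {i = c} {j = c'} e w) v≢u with go w v≢u
  ... | inj₂ exit = inj₂ exit
  ... | inj₁ (w' , c'≢u) with c ≟ u
  ...   | yes refl = inj₂ (c' , e , w')
  ...   | no c≢u = inj₁ (∧-true e (∧-true (minus-true c≢u) (minus-true c'≢u)) ◅ w' , c≢u)
... | inj₁ (_ , u≢u) = ⊥-elim (u≢u refl)
... | inj₂ exit = exit

module SpanningTree {n} (G : Graph n) (S : VSet n) (T : EdgeSet n) (t : IsSpanningTree G S T) where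

  undirected : Undirected T
  undirected = proj₁ (proj₁ t)

  edge-adj : ∀ {u v} → Edge T u v → Edge (adj G) u v
  edge-adj e = proj₁ (proj₁ (proj₂ (proj₁ t)) _ _ e)

  edge-in : ∀ {u v} → Edge T u v → S u ≡ true × S v ≡ true
  edge-in e = proj₂ (proj₁ (proj₂ (proj₁ t)) _ _ e)

  acyclic : Acyclic T
  acyclic = proj₂ (proj₂ (proj₁ t))

  connected : ∀ {u v} → S u ≡ true → S v ≡ true → Conn T u v
  connected = proj₂ t _ _

  no-loop : ∀ {u} → ¬ Edge T u u
  no-loop {u} e = true⇒≢false (edge-adj e) (loopless G u)

  outside-isolated : ∀ {u} → S u ≡ false → ∀ w → T u w ≡ false
  outside-isolated Su w = ¬true⇒false λ e → true⇒≢false (proj₁ (edge-in e)) Su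

  outside-deg : ∀ {u} → S u ≡ false → deg T u ≡ 0
  outside-deg {u} Su = deg-none {T = T} {u} (outside-isolated Su)

  neighbour : ∀ {u w} → S u ≡ true → S w ≡ true → u ≢ w → ∃ λ b → Edge T u b
  neighbour Su Sw u≢w with connected Su Sw
  ... | ε = ⊥-elim (u≢w refl)
  ... | _◅_ {j = b} e _ = b , e

tree-resp : ∀ {n} {G : Graph n} {S S' : VSet n} {T : EdgeSet n} →
            (∀ a → S a ≡ true → S' a ≡ true) → (∀ a → S' a ≡ true → S a ≡ true) →
            IsSpanningTree G S T → IsSpanningTree G S' T
tree-resp S⊆S' S'⊆S ((und , inside , acyclic) , connected) =
  (und , (λ u v e → let (a , Su , Sv) = inside u v e in a , S⊆S' u Su , S⊆S' v Sv) , acyclic) ,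
  λ u v Su Sv → connected u v (S'⊆S u Su) (S'⊆S v Sv)

-- Gluing trees

_∪ₑ_ : ∀ {n} → EdgeSet n → EdgeSet n → EdgeSet n
(A ∪ₑ B) a b = A a b ∨ B a b

_∪ᵥ_ : ∀ {n} → VSet n → VSet n → VSet n
(S ∪ᵥ S') a = S a ∨ S' a

module _ {N} {G : Graph N} {A B : EdgeSet N} {SA SB : VSet N} {c : Fin N}
         (tA : IsSpanningTree G SA A) (tB : IsSpanningTree G SB B)
         (meet : ∀ {w} → SA w ≡ true → SB w ≡ true → w ≡ c) where

  private
    module TA = SpanningTree G SA A tA
    module TB = SpanningTree G SB B tB

    -- collapsing the B side onto c maps walks of A ∪ B to walks of A, so a cycle through an
    -- A-edge would already be a cycle of A
    retract : Fin N → Fin N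
    retract w = if SA w then w else c

    retract-A : ∀ {w} → SA w ≡ true → retract w ≡ w
    retract-A e rewrite e = refl

    retract-B : ∀ {w} → SB w ≡ true → retract w ≡ c
    retract-B {w} e with SA w in eq
    ... | true = meet eq e
    ... | false = refl

    retract-walk : ∀ {u v a b} → Conn (deleteEdge (A ∪ₑ B) u v) a b →
                   Conn (deleteEdge A u v) (retract a) (retract b)
    retract-walk ε = ε
    retract-walk {u} {v} (_◅_ {i = a} {j = b} e w) with deleteEdge⁻ {T = A ∪ₑ B} {u} {v} e
    ... | e' , ¬uv , ¬vu with ∨-true⁻ {A a b} e'
    ...   | inj₁ ab =
      subst₂ (Edge (deleteEdge A u v))
             (sym (retract-A (proj₁ (TA.edge-in ab)))) (sym (retract-A (proj₂ (TA.edge-in ab))))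
             (deleteEdge⁺ {T = A} {u} {v} ab ¬uv ¬vu)
      ◅ retract-walk w
    ...   | inj₂ ab =
      subst (λ z → Conn (deleteEdge A u v) z (retract _))
            (trans (retract-B (proj₂ (TB.edge-in ab))) (sym (retract-B (proj₁ (TB.edge-in ab)))))
            (retract-walk w)

  ∪-acyclicˡ : ∀ u v → Edge A u v → ¬ Conn (deleteEdge (A ∪ₑ B) u v) u v
  ∪-acyclicˡ u v e w =
    TA.acyclic u v e (walk-subst (retract-A (proj₁ (TA.edge-in e))) (retract-A (proj₂ (TA.edge-in e))) (retract-walk w))

tree-∪ : ∀ {N} {G : Graph N} {A B : EdgeSet N} {SA SB : VSet N} {c : Fin N} →
         IsSpanningTree G SA A → IsSpanningTree G SB B → SA c ≡ true → SB c ≡ true →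
         (∀ {w} → SA w ≡ true → SB w ≡ true → w ≡ c) →
         IsSpanningTree G (SA ∪ᵥ SB) (A ∪ₑ B)
tree-∪ {G = G} {A} {B} {SA} {SB} {c} tA tB cA cB meet = (undirected , inside , acyclic) , connected
  where
  module TA = SpanningTree G SA A tA
  module TB = SpanningTree G SB B tB
  undirected : Undirected (A ∪ₑ B)
  undirected u v = cong₂ _∨_ (TA.undirected u v) (TB.undirected u v)
  inside : ∀ u v → Edge (A ∪ₑ B) u v → Edge (adj G) u v × (SA ∪ᵥ SB) u ≡ true × (SA ∪ᵥ SB) v ≡ true
  inside u v e with ∨-true⁻ {A u v} e
  ... | inj₁ p = TA.edge-adj p , ∨-trueˡ _ (proj₁ (TA.edge-in p)) , ∨-trueˡ _ (proj₂ (TA.edge-in p))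
  ... | inj₂ p = TB.edge-adj p , ∨-trueʳ (SA u) (proj₁ (TB.edge-in p)) , ∨-trueʳ (SA v) (proj₂ (TB.edge-in p))
  ∪-comm : (A ∪ₑ B) ⊆ₑ (B ∪ₑ A)
  ∪-comm {a} {b} e = trans (∨-comm (B a b) (A a b)) e
  acyclic : Acyclic (A ∪ₑ B)
  acyclic u v e w with ∨-true⁻ {A u v} e
  ... | inj₁ p = ∪-acyclicˡ {G = G} {A} {B} {SA} {SB} {c} tA tB meet u v p w
  ... | inj₂ p = ∪-acyclicˡ {G = G} {B} {A} {SB} {SA} {c} tB tA (λ b a → meet a b) u v p
                   (Star.map (deleteEdge-mono {A = A ∪ₑ B} {B ∪ₑ A} {u} {v} ∪-comm) w)
  liftA : ∀ {a b} → Conn A a b → Conn (A ∪ₑ B) a b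
  liftA = Star.map λ {a} {b} → ∨-trueˡ (B a b)
  liftB : ∀ {a b} → Conn B a b → Conn (A ∪ₑ B) a b
  liftB = Star.map λ {a} {b} → ∨-trueʳ (A a b)
  connected : ∀ u v → (SA ∪ᵥ SB) u ≡ true → (SA ∪ᵥ SB) v ≡ true → Conn (A ∪ₑ B) u v
  connected u v Su Sv with ∨-true⁻ {SA u} Su | ∨-true⁻ {SA v} Sv
  ... | inj₁ p | inj₁ q = liftA (TA.connected p q)
  ... | inj₂ p | inj₂ q = liftB (TB.connected p q)
  ... | inj₁ p | inj₂ q = liftA (TA.connected p cA) ◅◅ liftB (TB.connected cB q)
  ... | inj₂ p | inj₁ q = liftB (TB.connected p cB) ◅◅ liftA (TA.connected cA q)

⋃ : ∀ {X : Set} → (ℕ → X → Bool) → ℕ → X → Bool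
⋃ P zero = P zero
⋃ P (suc t) x = ⋃ P t x ∨ P (suc t) x

⋃ₑ : ∀ {N} → (ℕ → EdgeSet N) → ℕ → EdgeSet N
⋃ₑ E M a = ⋃ (λ t → E t a) M

⋃⁺ : ∀ {X : Set} (P : ℕ → X → Bool) {t M x} → t ≤ M → P t x ≡ true → ⋃ P M x ≡ true
⋃⁺ P {M = zero} z≤n p = p
⋃⁺ P {t} {suc M} {x} t≤ p with m≤n⇒m<n∨m≡n t≤
... | inj₁ t< = ∨-trueˡ _ (⋃⁺ P (s≤s⁻¹ t<) p)
... | inj₂ refl = ∨-trueʳ (⋃ P M x) p

⋃⁻ : ∀ {X : Set} (P : ℕ → X → Bool) {M x} → ⋃ P M x ≡ true → ∃ λ t → t ≤ M × P t x ≡ true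
⋃⁻ P {zero} p = 0 , z≤n , p
⋃⁻ P {suc M} {x} p with ∨-true⁻ {⋃ P M x} p
... | inj₂ q = suc M , ≤-refl , q
... | inj₁ q with ⋃⁻ P q
...   | t , t≤ , r = t , m≤n⇒m≤1+n t≤ , r

chain-tree : ∀ {N} {G : Graph N} (E : ℕ → EdgeSet N) (V : ℕ → VSet N) M →
             (∀ t → t ≤ M → IsSpanningTree G (V t) (E t)) →
             (∀ t → t < M → ∃ λ c → ⋃ V t c ≡ true × V (suc t) c ≡ true ×
                                     (∀ {w} → ⋃ V t w ≡ true → V (suc t) w ≡ true → w ≡ c)) →
             IsSpanningTree G (⋃ V M) (⋃ₑ E M)
chain-tree E V zero trees _ = trees 0 z≤n
chain-tree {G = G} E V (suc M) trees meets with meets M ≤-refl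
... | c , c₁ , c₂ , unique =
  tree-∪ {G = G} {⋃ₑ E M} {E (suc M)} {⋃ V M} {V (suc M)} {c}
         (chain-tree {G = G} E V M (λ t t≤ → trees t (m≤n⇒m≤1+n t≤)) (λ t t< → meets t (m≤n⇒m≤1+n t<)))
         (trees (suc M) ≤-refl) c₁ c₂ unique

module _ {n N} (f : Fin n → Fin N) where

  image? : (S : VSet n) (a : Fin N) → Dec (∃ λ u → S u ≡ true × f u ≡ a)
  image? S a = any? λ u → (S u ≟ᵇ true) ×-dec (f u ≟ a)

  imageₑ? : (F : EdgeSet n) (a b : Fin N) → Dec (∃ λ u → ∃ λ w → F u w ≡ true × f u ≡ a × f w ≡ b)
  imageₑ? F a b = any? λ u → any? λ w → (F u w ≟ᵇ true) ×-dec ((f u ≟ a) ×-dec (f w ≟ b))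

  imageᵥ : VSet n → VSet N
  imageᵥ S a = does (image? S a)

  imageₑ : EdgeSet n → EdgeSet N
  imageₑ F a b = does (imageₑ? F a b)

  imageᵥ⁺ : ∀ {S u} → S u ≡ true → imageᵥ S (f u) ≡ true
  imageᵥ⁺ {S} {u} Su = dec-true (image? S (f u)) (u , Su , refl)

  imageᵥ⁻ : ∀ {S a} → imageᵥ S a ≡ true → ∃ λ u → S u ≡ true × f u ≡ a
  imageᵥ⁻ {S} {a} = does-true⁻ (image? S a)

  imageₑ⁺ : ∀ {F u w} → Edge F u w → Edge (imageₑ F) (f u) (f w)
  imageₑ⁺ {F} {u} {w} e = dec-true (imageₑ? F (f u) (f w)) (u , w , e , refl , refl)

  imageₑ⁻ : ∀ {F a b} → Edge (imageₑ F) a b → ∃ λ u → ∃ λ w → Edge F u w × f u ≡ a × f w ≡ b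
  imageₑ⁻ {F} {a} {b} = does-true⁻ (imageₑ? F a b)

image-tree : ∀ {n N} {H : Graph n} {G : Graph N} (f : Fin n → Fin N) → Injective _≡_ _≡_ f →
             (∀ {u w} → Edge (adj H) u w → Edge (adj G) (f u) (f w)) →
             ∀ {S F} → IsSpanningTree H S F → IsSpanningTree G (imageᵥ f S) (imageₑ f F)
image-tree {H = H} {G} f f-inj f-adj {S} {F} tF = (undirected , inside , acyclic) , connected
  where
  module TF = SpanningTree H S F tF
  flip : ∀ {a b} → Edge (imageₑ f F) a b → Edge (imageₑ f F) b a
  flip e with imageₑ⁻ f e
  ... | u , w , e' , refl , refl = imageₑ⁺ f (edge-sym TF.undirected e')
  undirected : Undirected (imageₑ f F)
  undirected a b = bool-ext flip flip
  inside : ∀ a b → Edge (imageₑ f F) a b → Edge (adj G) a b × imageᵥ f S a ≡ true × imageᵥ f S b ≡ true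
  inside a b e with imageₑ⁻ f e
  ... | u , w , e' , refl , refl =
    f-adj (TF.edge-adj e') , imageᵥ⁺ f (proj₁ (TF.edge-in e')) , imageᵥ⁺ f (proj₂ (TF.edge-in e'))
  lift : ∀ {u₀ w₀ a b} → Conn (deleteEdge (imageₑ f F) (f u₀) (f w₀)) a b →
         ∀ {u} → f u ≡ a → ∃ λ w → f w ≡ b × Conn (deleteEdge F u₀ w₀) u w
  lift ε {u} p = u , p , ε
  lift {u₀} {w₀} (e ◅ rest) {u} p with deleteEdge⁻ {T = imageₑ f F} {f u₀} {f w₀} e
  ... | e' , ¬uw , ¬wu with imageₑ⁻ f e'
  ...   | u₁ , w₁ , e₁ , p₁ , q₁ with f-inj (trans p₁ (sym p))
  ...     | refl with lift rest q₁
  ...       | w , q , walk =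
    w , q , deleteEdge⁺ {T = F} {u₀} {w₀} e₁ (λ (r , s) → ¬uw (trans (sym p₁) (cong f r) , trans (sym q₁) (cong f s)))
                                          (λ (r , s) → ¬wu (trans (sym p₁) (cong f r) , trans (sym q₁) (cong f s)))
            ◅ walk
  acyclic : Acyclic (imageₑ f F)
  acyclic a b e walk with imageₑ⁻ f e
  ... | u , w , e' , refl , refl with lift walk refl
  ...   | w' , q , walk' rewrite f-inj q = TF.acyclic u w e' walk'
  connected : ∀ a b → imageᵥ f S a ≡ true → imageᵥ f S b ≡ true → Conn (imageₑ f F) a b
  connected a b Sa Sb with imageᵥ⁻ f Sa | imageᵥ⁻ f Sb
  ... | u , Su , refl | w , Sw , refl = Star.gmap f (imageₑ⁺ f) (TF.connected Su Sw)

module Component {q} (G : Graph q) (S : VSet q) (T : EdgeSet q) (c c' : Fin q)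
                 (forest : IsSpanningForest G S T)
                 (reach : ∀ v → S v ≡ true → Conn T c v ⊎ Conn T c' v)
                 (separated : ¬ Conn T c c') (Sc : S c ≡ true) where

  private
    undirected : Undirected T
    undirected = proj₁ forest

    inside : ∀ {u w} → Edge T u w → Edge (adj G) u w × S u ≡ true × S w ≡ true
    inside = proj₁ (proj₂ forest) _ _

    -- connectivity is not decidable here: membership is read off the root chosen by reach
    side : ∀ v → S v ≡ true ⊎ S v ≡ false → Bool
    side v (inj₂ _) = false
    side v (inj₁ Sv) with reach v Sv
    ... | inj₁ _ = true
    ... | inj₂ _ = false

  -- abstract, so that v can be inferred from part v ≡ true
  abstract
    part : VSet q
    part v = side v (true-or-false (S v))

    part⁻ : ∀ {v} → part v ≡ true → S v ≡ true × Conn T c v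
    part⁻ {v} e with true-or-false (S v)
    ... | inj₁ Sv with reach v Sv
    ...   | inj₁ w = Sv , w

    part-false⁻ : ∀ {v} → S v ≡ true → part v ≡ false → Conn T c' v
    part-false⁻ {v} Sv' e with true-or-false (S v)
    ... | inj₂ Sv = ⊥-elim (true⇒≢false Sv' Sv)
    ... | inj₁ Sv with reach v Sv
    ...   | inj₂ w = w

  part⁺ : ∀ {v} → S v ≡ true → Conn T c v → part v ≡ true
  part⁺ {v} Sv w = ¬false⇒true λ f → separated (w ◅◅ walk-reverse undirected (part-false⁻ Sv f))

  part-c : part c ≡ true
  part-c = part⁺ Sc ε

  part-c' : part c' ≡ false
  part-c' = ¬true⇒false λ e → separated (proj₂ (part⁻ e))

  part-closed : ∀ {u w} → Edge T u w → part u ≡ true → part w ≡ true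
  part-closed e pu = part⁺ (proj₂ (proj₂ (inside e))) (proj₂ (part⁻ pu) ◅◅ (e ◅ ε))

  partₑ : EdgeSet q
  partₑ u w = T u w ∧ part u

  part-tree : IsSpanningTree G part partₑ
  part-tree =
    (undirectedₚ , insideₚ , Acyclic-mono (λ {a} {b} → ∧-conicalˡ (T a b) (part a)) (proj₂ (proj₂ forest))) ,
    connected
    where
    flip : ∀ {u w} → Edge partₑ u w → Edge partₑ w u
    flip {u} {w} e =
      ∧-true (edge-sym undirected (∧-conicalˡ _ _ e)) (part-closed (∧-conicalˡ _ _ e) (∧-conicalʳ (T u w) _ e))
    undirectedₚ : Undirected partₑ
    undirectedₚ u w = bool-ext flip flip
    insideₚ : ∀ u w → Edge partₑ u w → Edge (adj G) u w × part u ≡ true × part w ≡ true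
    insideₚ u w e = let e' = ∧-conicalˡ _ _ e ; pu = ∧-conicalʳ (T u w) _ e in
      proj₁ (inside e') , pu , part-closed e' pu
    lift : ∀ {a b} → Conn T a b → part a ≡ true → Conn partₑ a b
    lift ε _ = ε
    lift (e ◅ w) pa = ∧-true e pa ◅ lift w (part-closed e pa)
    connected : ∀ u w → part u ≡ true → part w ≡ true → Conn partₑ u w
    connected u w pu pw =
      walk-reverse undirectedₚ (lift (proj₂ (part⁻ pu)) part-c) ◅◅ lift (proj₂ (part⁻ pw)) part-c

module Cyclic (m : ℕ) where

  K : ℕ
  K = suc (suc m)

  rot : Fin K → ℕ → Fin K
  rot s zero = s
  rot s (suc t) = next (rot s t)

  rot-+ : ∀ s a d → rot s (a + d) ≡ rot (rot s a) d
  rot-+ s a zero = cong (rot s) (+-identityʳ a)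
  rot-+ s a (suc d) = trans (cong (rot s) (+-suc a d)) (cong next (rot-+ s a d))

  private
    %-absorbʳ : ∀ a b → (a + b % K) % K ≡ (a + b) % K
    %-absorbʳ a b = begin
      (a + b % K) % K         ≡⟨ %-distribˡ-+ a (b % K) K ⟩
      (a % K + b % K % K) % K ≡⟨ cong (λ z → (a % K + z) % K) (m%n%n≡m%n b K) ⟩
      (a % K + b % K) % K     ≡⟨ %-distribˡ-+ a b K ⟨
      (a + b) % K             ∎
      where open ≡-Reasoning

  toℕ-rot : ∀ s t → toℕ (rot s t) ≡ (toℕ s + t) % K
  toℕ-rot s zero = trans (sym (m<n⇒m%n≡m (toℕ<n s))) (cong (_% K) (sym (+-identityʳ (toℕ s))))
  toℕ-rot s (suc t) = begin
    toℕ (next (rot s t))      ≡⟨ toℕ-fromℕ< (m%n<n (suc (toℕ (rot s t))) K) ⟩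
    (1 + toℕ (rot s t)) % K   ≡⟨ cong (λ z → (1 + z) % K) (toℕ-rot s t) ⟩
    (1 + (toℕ s + t) % K) % K ≡⟨ %-absorbʳ 1 (toℕ s + t) ⟩
    suc (toℕ s + t) % K       ≡⟨ cong (_% K) (+-suc (toℕ s) t) ⟨
    (toℕ s + suc t) % K       ∎
    where open ≡-Reasoning

  rot-K : ∀ s → rot s K ≡ s
  rot-K s = toℕ-injective (trans (toℕ-rot s K) (trans ([m+n]%n≡m%n (toℕ s) K) (m<n⇒m%n≡m (toℕ<n s))))

  rot-onto : ∀ s i → ∃ λ t → t < K × rot s t ≡ i
  rot-onto s i = t % K , m%n<n t K , trans rot-% (toℕ-injective reach)
    where
    -- i − s, shifted by K to stay non-negative
    t : ℕ
    t = toℕ i + (K ∸ toℕ s)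
    rot-% : rot s (t % K) ≡ rot s t
    rot-% = toℕ-injective (trans (toℕ-rot s (t % K)) (trans (%-absorbʳ (toℕ s) t) (sym (toℕ-rot s t))))
    s+t : toℕ s + t ≡ toℕ i + K
    s+t = begin
      toℕ s + (toℕ i + (K ∸ toℕ s)) ≡⟨ +-assoc (toℕ s) (toℕ i) _ ⟨
      toℕ s + toℕ i + (K ∸ toℕ s)   ≡⟨ cong (_+ (K ∸ toℕ s)) (+-comm (toℕ s) (toℕ i)) ⟩
      toℕ i + toℕ s + (K ∸ toℕ s)   ≡⟨ +-assoc (toℕ i) (toℕ s) _ ⟩
      toℕ i + (toℕ s + (K ∸ toℕ s)) ≡⟨ cong (toℕ i +_) (m+[n∸m]≡n (<⇒≤ (toℕ<n s))) ⟩
      toℕ i + K                     ∎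
      where open ≡-Reasoning
    reach : toℕ (rot s t) ≡ toℕ i
    reach = trans (toℕ-rot s t) (trans (cong (_% K) s+t) (trans ([m+n]%n≡m%n (toℕ i) K) (m<n⇒m%n≡m (toℕ<n i))))

  private
    %-period : ∀ r d → r < K → 0 < d → d ≤ K → (r + d) % K ≡ r → d ≡ K
    %-period r d r<K 0<d d≤K e with m≤n⇒m<n∨m≡n d≤K
    ... | inj₂ d≡K = d≡K
    ... | inj₁ d<K with r + d <? K
    ...   | yes r+d<K = ⊥-elim (<⇒≢ 0<d (sym (+-cancelˡ-≡ r d 0 (begin
        r + d       ≡⟨ m<n⇒m%n≡m r+d<K ⟨
        (r + d) % K ≡⟨ e ⟩
        r           ≡⟨ +-identityʳ r ⟨
        r + 0       ∎))))
      where open ≡-Reasoning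
    ...   | no r+d≮K =
      ⊥-elim (<-irrefl wrapped (+-cancelʳ-< K _ _ (subst (_< r + K) (sym (m∸n+n≡m K≤)) (+-monoʳ-< r d<K))))
      where
      K≤ : K ≤ r + d
      K≤ = ≮⇒≥ r+d≮K
      wrapped : r + d ∸ K ≡ r
      wrapped = trans (sym (m<n⇒m%n≡m (+-cancelʳ-< K _ _ (subst (_< K + K) (sym (m∸n+n≡m K≤)) (+-mono-< r<K d<K)))))
                      (trans (m≤n⇒[n∸m]%m≡n%m K≤) e)

  rot-period : ∀ s d → 0 < d → d ≤ K → rot s d ≡ s → d ≡ K
  rot-period s d 0<d d≤K e = %-period (toℕ s) d (toℕ<n s) 0<d d≤K (trans (sym (toℕ-rot s d)) (cong toℕ e))

  rot-injective : ∀ s {a b} → a < b → b ≤ K → rot s a ≡ rot s b → a ≡ 0 × b ≡ K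
  rot-injective s {a} {b} a<b b≤K e = a≡0 , trans (sym split) (trans (cong (_+ (b ∸ a)) a≡0) gap≡K)
    where
    split : a + (b ∸ a) ≡ b
    split = m+[n∸m]≡n (<⇒≤ a<b)
    gap≡K : b ∸ a ≡ K
    gap≡K = rot-period (rot s a) (b ∸ a) (m<n⇒0<n∸m a<b) (≤-trans (m∸n≤m b a) b≤K)
              (trans (sym (rot-+ s a (b ∸ a))) (trans (cong (rot s) split) (sym e)))
    a≡0 : a ≡ 0
    a≡0 = n≤0⇒n≡0 (+-cancelʳ-≤ K a 0 (subst (λ z → a + z ≤ K) gap≡K (subst (_≤ K) (sym split) b≤K)))

  next-injective : ∀ {i j : Fin K} → next i ≡ next j → i ≡ j
  next-injective {i} {j} e with rot-onto j i
  ... | zero , _ , j≡i = sym j≡i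
  ... | suc t , t<K , rot≡i with rot-injective j (s≤s (s≤s z≤n)) t<K (trans (sym e) (cong next (sym rot≡i)))
  ...   | () , _

  next≢ : ∀ (i : Fin K) → next i ≢ i
  next≢ i e with rot-period i 1 (s≤s z≤n) (s≤s z≤n) e
  ... | ()

  prev : Fin K → Fin K
  prev i = rot i (suc m)

  next-prev : ∀ i → next (prev i) ≡ i
  next-prev = rot-K

  two-indices : ∀ p → next (next p) ≡ p → ∀ i → i ≡ p ⊎ i ≡ next p
  two-indices p e i with rot-period p 2 (s≤s z≤n) (s≤s (s≤s z≤n)) e
  ... | K≡2 with rot-onto p i
  ...   | t , t<K , rot≡i with subst (t <_) (sym K≡2) t<K
  ...     | s≤s z≤n = inj₁ (sym rot≡i)
  ...     | s≤s (s≤s z≤n) = inj₂ (sym rot≡i)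

module Fragment {q} (F : Graph q) (x y : Fin q) (frag : IsHISTCriticalFragment F x y) where

  three≤ : 3 ≤ q
  three≤ = proj₁ frag

  x≢y : x ≢ y
  x≢y = proj₁ (proj₂ frag)

  hist : EdgeSet q
  hist = proj₁ (proj₁ (proj₁ (proj₂ (proj₂ frag))))

  hist-is : IsExclHIST F full (Pair x y) hist
  hist-is = proj₂ (proj₁ (proj₁ (proj₂ (proj₂ frag))))

  hist-degrees : ∀ T → IsExclHIST F full (Pair x y) T → deg T x ≡ 2 × deg T y ≡ 2
  hist-degrees = proj₂ (proj₁ (proj₂ (proj₂ frag)))

  hist-deg-x : deg hist x ≡ 2
  hist-deg-x = proj₁ (hist-degrees hist hist-is)

  hist-deg-y : deg hist y ≡ 2
  hist-deg-y = proj₂ (hist-degrees hist hist-is)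

  hist-x : EdgeSet q
  hist-x = proj₁ (proj₁ (proj₁ (proj₂ (proj₂ (proj₂ frag)))))

  hist-x-is : IsExclHIST F (minus x) (Pair x y) hist-x
  hist-x-is = proj₁ (proj₂ (proj₁ (proj₁ (proj₂ (proj₂ (proj₂ frag))))))

  hist-x-deg : deg hist-x y ≢ 1
  hist-x-deg = proj₂ (proj₂ (proj₁ (proj₁ (proj₂ (proj₂ (proj₂ frag))))))

  hist-y : EdgeSet q
  hist-y = proj₁ (proj₂ (proj₁ (proj₂ (proj₂ (proj₂ frag)))))

  hist-y-is : IsExclHIST F (minus y) (Pair x y) hist-y
  hist-y-is = proj₁ (proj₂ (proj₂ (proj₁ (proj₂ (proj₂ (proj₂ frag))))))

  hist-y-deg : deg hist-y x ≢ 1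
  hist-y-deg = proj₂ (proj₂ (proj₂ (proj₁ (proj₂ (proj₂ (proj₂ frag))))))

  inner-removal : ∀ v → v ≢ x → v ≢ y →
    (∃ λ T → IsExclHIST F (minus v) (Pair x y) T × (deg T x ≢ 2 ⊎ deg T y ≢ 2))
    ⊎ (∃ λ T → IsTwoCompHISF F (minus v) x y T)
  inner-removal = proj₁ (proj₂ (proj₂ (proj₂ (proj₂ frag))))

  no-two-component : ¬ (∃ λ T → IsTwoCompHISF F full x y T)
  no-two-component = proj₂ (proj₂ (proj₂ (proj₂ (proj₂ frag))))

  another : ∀ (a b : Fin q) → ∃ λ w → w ≢ a × w ≢ b
  another = avoid-two three≤
    where
    avoid-two : ∀ {q} → 3 ≤ q → (a b : Fin q) → ∃ λ w → w ≢ a × w ≢ b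
    avoid-two (s≤s (s≤s (s≤s z≤n))) a b with zero ≟ a | zero ≟ b
    ... | no p | no r = zero , p , r
    ... | yes refl | _ with suc zero ≟ b
    ...   | no r = suc zero , (λ ()) , r
    ...   | yes refl = suc (suc zero) , (λ ()) , (λ ())
    avoid-two (s≤s (s≤s (s≤s z≤n))) a b | no p | yes refl with suc zero ≟ a
    ...   | no r = suc zero , r , (λ ())
    ...   | yes refl = suc (suc zero) , (λ ()) , (λ ())

module RootedForest {q} (F : Graph q) (x y : Fin q) (frag : IsHISTCriticalFragment F x y)
                    (R : EdgeSet q) (forest : IsSpanningForest F full R)
                    (inner-deg : ∀ v → ¬ Pair x y v → deg R v ≢ 2)
                    (rooted : ∀ v → Conn R x v ⊎ Conn R y v) where

  open Fragment F x y frag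

  private
    undirected : Undirected R
    undirected = proj₁ forest

    acyclic : Acyclic R
    acyclic = proj₂ (proj₂ forest)

  linked⇒hist : Conn R x y → IsExclHIST F full (Pair x y) R
  linked⇒hist x~y = (forest , λ u v _ _ → walk-reverse undirected (from-x u) ◅◅ from-x v) , λ v _ → inner-deg v
    where
    from-x : ∀ u → Conn R x u
    from-x u = [ id , x~y ◅◅_ ]′ (rooted u)

  attached⇒¬¬linked : ∃ (Edge R x) → ∃ (Edge R y) → ¬ ¬ Conn R x y
  attached⇒¬¬linked x-edge y-edge ¬x~y =
    no-two-component (R , forest , (λ v _ → inner-deg v) , ¬x~y , (λ v _ → rooted v) , x-edge , y-edge)

  -- an edge xy would split R into two components, each keeping a second neighbour of x or y
  linked⇒no-xy : Conn R x y → ¬ Edge R x y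
  linked⇒no-xy x~y xy = no-two-component (R' , forest' , degrees' , acyclic x y xy , rooted' , other-x , other-y)
    where
    R' : EdgeSet q
    R' = deleteEdge R x y
    forest' : IsSpanningForest F full R'
    forest' = deleteEdge-undirected {T = R} undirected ,
              (λ u w e → proj₁ (proj₁ (proj₂ forest) u w (proj₁ (deleteEdge⁻ {T = R} {x} {y} e))) , refl , refl) ,
              Acyclic-mono (λ {a} {b} e → proj₁ (deleteEdge⁻ {T = R} {x} {y} {a} {b} e)) acyclic
    degrees' : ∀ v → full v ≡ true → ¬ Pair x y v → deg R' v ≢ 2
    degrees' v _ ¬xy = inner-deg v ¬xy ∘ trans (deg-cong {T = R} {R'} λ w →
      bool-ext (λ e → deleteEdge⁺ {T = R} e (¬xy ∘ inj₁ ∘ proj₁) (¬xy ∘ inj₂ ∘ proj₁))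
               (λ e → proj₁ (deleteEdge⁻ {T = R} {x} {y} e)))
    undirected' : Undirected R'
    undirected' = deleteEdge-undirected {T = R} {x} {y} undirected
    rooted' : ∀ v → full v ≡ true → Conn R' x v ⊎ Conn R' y v
    rooted' v _ =
      [ back (inj₁ refl) ∘ walk-reverse undirected , back (inj₂ refl) ∘ walk-reverse undirected ]′ (rooted v)
      where
      back : ∀ {r} → r ≡ x ⊎ r ≡ y → Conn R v r → Conn R' x v ⊎ Conn R' y v
      back r∈xy w with walk-split R x y w | r∈xy
      ... | inj₁ w' | inj₁ refl = inj₁ (walk-reverse undirected' w')
      ... | inj₁ w' | inj₂ refl = inj₂ (walk-reverse undirected' w')
      ... | inj₂ (inj₁ w') | _ = inj₁ (walk-reverse undirected' w')
      ... | inj₂ (inj₂ w') | _ = inj₂ (walk-reverse undirected' w')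
    degrees : deg R x ≡ 2 × deg R y ≡ 2
    degrees = hist-degrees R (linked⇒hist x~y)
    other-x : ∃ (Edge R' x)
    other-x with count≡2⇒other (R x) (trans (sym (deg≡count R x)) (proj₁ degrees)) y
    ... | a , e , a≢y = a , deleteEdge⁺ {T = R} e (a≢y ∘ proj₂) (x≢y ∘ proj₁)
    other-y : ∃ (Edge R' y)
    other-y with count≡2⇒other (R y) (trans (sym (deg≡count R y)) (proj₂ degrees)) x
    ... | a , e , a≢x = a , deleteEdge⁺ {T = R} e (x≢y ∘ sym ∘ proj₁) (a≢x ∘ proj₂)

module Gluing (m : ℕ) (n : Fin (suc (suc m)) → ℕ) (H : (i : Fin (suc (suc m))) → Graph (n i))
              (x y : (i : Fin (suc (suc m))) → Fin (n i))
              (frag : ∀ i → IsHISTCriticalFragment (H i) (x i) (y i))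
              (N : ℕ) (G : Graph N) (φ : Σ (Fin (suc (suc m))) (λ i → Fin (n i)) → Fin N)
              (gluing : IsCyclicGluing n H x y G φ) where

  open Cyclic m public
  module Fr (i : Fin K) = Fragment (H i) (x i) (y i) (frag i)

  ι : (i : Fin K) → Fin (n i) → Fin N
  ι i u = φ (i , u)

  junction : ∀ i → ι i (y i) ≡ ι (next i) (x (next i))
  junction = proj₁ gluing

  private
    identified : ∀ p q → φ p ≡ φ q → p ≡ q ⊎ Glued x y p q ⊎ Glued x y q p
    identified = proj₁ (proj₂ gluing)

    uip : ∀ {a b : Fin K} (p q : a ≡ b) → p ≡ q
    uip = Decidable⇒UIP.≡-irrelevant _≟_

    ,-injectiveʳ : ∀ {i} {u w : Fin (n i)} → (Σ (Fin K) (Fin ∘ n) ∋ (i , u)) ≡ (i , w) → u ≡ w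
    ,-injectiveʳ = ,-injectiveʳ-UIP uip

  ι-onto : ∀ a → ∃ λ p → φ p ≡ a
  ι-onto = proj₁ (proj₂ (proj₂ gluing))

  edge-source : ∀ {a b} → Edge (adj G) a b →
                ∃ λ i → ∃ λ u → ∃ λ w → Edge (adj (H i)) u w × ι i u ≡ a × ι i w ≡ b
  edge-source = proj₁ (proj₂ (proj₂ (proj₂ gluing))) _ _

  ι-edge : ∀ i {u w} → Edge (adj (H i)) u w → Edge (adj G) (ι i u) (ι i w)
  ι-edge i = proj₂ (proj₂ (proj₂ (proj₂ gluing))) i _ _

  ι-injective : ∀ i {u w} → ι i u ≡ ι i w → u ≡ w
  ι-injective i {u} {w} e with identified (i , u) (i , w) e
  ... | inj₁ p = ,-injectiveʳ p
  ... | inj₂ (inj₁ (g , p , q)) = ⊥-elim (next≢ g (trans (sym (,-injectiveˡ q)) (,-injectiveˡ p)))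
  ... | inj₂ (inj₂ (g , p , q)) = ⊥-elim (next≢ g (trans (sym (,-injectiveˡ q)) (,-injectiveˡ p)))

  ι-cross : ∀ i {u} l {w} → ι i u ≡ ι l w → i ≢ l →
            (u ≡ y i × l ≡ next i × w ≡ x l) ⊎ (u ≡ x i × i ≡ next l × w ≡ y l)
  ι-cross i {u} l {w} e i≢l with identified (i , u) (l , w) e
  ... | inj₁ p = ⊥-elim (i≢l (,-injectiveˡ p))
  ... | inj₂ (inj₁ (g , refl , refl)) = inj₁ (refl , refl , refl)
  ... | inj₂ (inj₂ (g , refl , refl)) = inj₂ (refl , refl , refl)

  Inner : (i : Fin K) → Fin (n i) → Set
  Inner i u = u ≢ x i × u ≢ y i

  Inner⁺ : ∀ {i u} → ¬ Pair (x i) (y i) u → Inner i u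
  Inner⁺ ¬xy = ¬xy ∘ inj₁ , ¬xy ∘ inj₂

  Inner⁻ : ∀ {i u} → Inner i u → ¬ Pair (x i) (y i) u
  Inner⁻ (u≢x , _) (inj₁ u≡x) = u≢x u≡x
  Inner⁻ (_ , u≢y) (inj₂ u≡y) = u≢y u≡y

  inner-unique : ∀ {i u l w} → Inner i u → ι i u ≡ ι l w →
                 (Σ (Fin K) (Fin ∘ n) ∋ (i , u)) ≡ (l , w)
  inner-unique {i} {u} {l} {w} (u≢x , u≢y) e with identified (i , u) (l , w) e
  ... | inj₁ p = p
  ... | inj₂ (inj₁ (g , refl , _)) = ⊥-elim (u≢y refl)
  ... | inj₂ (inj₂ (g , _ , refl)) = ⊥-elim (u≢x refl)

  at-junction : ∀ p {l u} → ι l u ≡ ι p (y p) →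
                (Σ (Fin K) (Fin ∘ n) ∋ (l , u)) ≡ (p , y p) ⊎ (Σ (Fin K) (Fin ∘ n) ∋ (l , u)) ≡ (next p , x (next p))
  at-junction p {l} {u} e with identified (l , u) (p , y p) e
  ... | inj₁ q = inj₁ q
  ... | inj₂ (inj₁ (g , q , r)) with ,-injectiveˡ r
  ...   | refl = ⊥-elim (Fr.x≢y (next g) (sym (,-injectiveʳ r)))
  at-junction p e | inj₂ (inj₂ (g , q , r)) with ,-injectiveˡ q
  ...   | refl with ,-injectiveʳ q
  ...     | refl = inj₂ r

  vertex-cases : ∀ a → (∃ λ i → ∃ λ u → Inner i u × ι i u ≡ a) ⊎ (∃ λ p → ι p (y p) ≡ a)
  vertex-cases a with ι-onto a
  ... | (i , u) , e with u ≟ x i | u ≟ y i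
  ...   | _ | yes refl = inj₂ (i , e)
  ...   | yes refl | no _ = inj₂ (prev i , trans (junction (prev i)) (trans (cong (λ j → ι j (x j)) (next-prev i)) e))
  ...   | no u≢x | no u≢y = inj₁ (i , u , (u≢x , u≢y) , e)

  NoCollision : (E : ∀ i → EdgeSet (n i)) → Fin K → Set
  NoCollision E p = ∀ {w w'} → Edge (E p) (y p) w → Edge (E (next p)) (x (next p)) w' → ι p w ≢ ι (next p) w'

  -- the only collisions are loops, or the two x–y edges when K = 2
  no-collision : ∀ (E : ∀ i → EdgeSet (n i)) p → ¬ Edge (E p) (y p) (y p) →
                 next (next p) ≢ p ⊎ ¬ Edge (E p) (y p) (x p) ⊎ ¬ Edge (E (next p)) (x (next p)) (y (next p)) →
                 NoCollision E p
  no-collision E p no-loop alt e e' col with ι-cross p (next p) col (next≢ p ∘ sym)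
  ... | inj₁ (refl , _ , _) = no-loop e
  ... | inj₂ (refl , p≡nnp , refl) with alt
  ...   | inj₁ nnp≢p = nnp≢p (sym p≡nnp)
  ...   | inj₂ (inj₁ ¬e) = ¬e e
  ...   | inj₂ (inj₂ ¬e') = ¬e' e'

  no-collision-isolated : ∀ (E : ∀ i → EdgeSet (n i)) p →
                          (∀ w → E p (y p) w ≡ false) ⊎ (∀ w → E (next p) (x (next p)) w ≡ false) →
                          NoCollision E p
  no-collision-isolated E p (inj₁ none) {w} e _ _ = true⇒≢false e (none w)
  no-collision-isolated E p (inj₂ none) {w' = w'} _ e' _ = true⇒≢false e' (none w')

  module Assembled (E : ∀ i → EdgeSet (n i)) (T : EdgeSet N)
         (from : ∀ {a b} → Edge T a b → ∃ λ i → ∃ λ u → ∃ λ w → Edge (E i) u w × ι i u ≡ a × ι i w ≡ b)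
         (to : ∀ i {u w} → Edge (E i) u w → Edge T (ι i u) (ι i w)) where

    deg-inner : ∀ {i u} → Inner i u → deg T (ι i u) ≡ deg (E i) u
    deg-inner {i} {u} inner = begin
      deg T (ι i u)     ≡⟨ deg≡count T (ι i u) ⟩
      count (T (ι i u)) ≡⟨ count-image (ι i) (λ _ _ → ι-injective i) ((λ _ → to i) , onto) ⟩
      count (E i u)     ≡⟨ deg≡count (E i) u ⟨
      deg (E i) u       ∎
      where
      open ≡-Reasoning
      onto : ∀ b → T (ι i u) b ≡ true → ∃ λ w → E i u w ≡ true × ι i w ≡ b
      onto b e with from e
      ... | j , u' , w , e' , p , q with inner-unique inner (sym p)
      ...   | refl = w , e' , q

    deg-junction : ∀ p → NoCollision E p →
                   deg T (ι p (y p)) ≡ deg (E p) (y p) + deg (E (next p)) (x (next p))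
    deg-junction p no-col = begin
      deg T (ι p (y p))
        ≡⟨ deg≡count T _ ⟩
      count (T (ι p (y p)))
        ≡⟨ count-image₂ (ι p) (ι (next p)) (λ _ _ → ι-injective p) (λ _ _ → ι-injective (next p))
                         no-col (λ _ → to p) into onto ⟩
      count (E p (y p)) + count (E (next p) (x (next p)))
        ≡⟨ cong₂ _+_ (deg≡count (E p) (y p)) (deg≡count (E (next p)) (x (next p))) ⟨
      deg (E p) (y p) + deg (E (next p)) (x (next p))
        ∎
      where
      open ≡-Reasoning
      into : ∀ w → E (next p) (x (next p)) w ≡ true → T (ι p (y p)) (ι (next p) w) ≡ true
      into w e = subst (λ a → T a (ι (next p) w) ≡ true) (sym (junction p)) (to (next p) e)
      onto : ∀ b → T (ι p (y p)) b ≡ true →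
             (∃ λ w → E p (y p) w ≡ true × ι p w ≡ b) ⊎ (∃ λ w → E (next p) (x (next p)) w ≡ true × ι (next p) w ≡ b)
      onto b e with from e
      ... | j , u , w , e' , q , r with at-junction p q
      ...   | inj₁ refl = inj₁ (w , e' , r)
      ...   | inj₂ refl = inj₂ (w , e' , r)

  -- G − v has a HIST

  module Chain (s l : Fin K) (l→s : next l ≡ s) (E : ∀ i → EdgeSet (n i)) (S : ∀ i → VSet (n i))
               (tree : ∀ i → IsSpanningTree (H i) (S i) (E i))
               (has-x : ∀ i → i ≢ s → S i (x i) ≡ true)
               (has-y : ∀ i → i ≢ l → S i (y i) ≡ true)
               (cut : S s (x s) ≡ false ⊎ S l (y l) ≡ false) where

    pieceₑ : ℕ → EdgeSet N
    pieceₑ t = imageₑ (ι (rot s t)) (E (rot s t))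

    pieceᵥ : ℕ → VSet N
    pieceᵥ t = imageᵥ (ι (rot s t)) (S (rot s t))

    T : EdgeSet N
    T = ⋃ₑ pieceₑ (suc m)

    U : VSet N
    U = ⋃ pieceᵥ (suc m)

    private
      rot-last : rot s (suc m) ≡ l
      rot-last = next-injective (trans (rot-K s) (sym l→s))

      rot-distinct : ∀ {a b} → a < b → b ≤ suc m → rot s a ≢ rot s b
      rot-distinct a<b b≤ e with rot-injective s a<b (m≤n⇒m≤1+n b≤) e
      ... | _ , refl = 1+n≰n b≤

      x-in : ∀ {i} → i ≡ s → ∀ {u} → u ≡ x i → S i u ≡ true → S s (x s) ≡ true
      x-in refl refl Su = Su

      y-in : ∀ {i} → i ≡ l → ∀ {u} → u ≡ y i → S i u ≡ true → S l (y l) ≡ true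
      y-in refl refl Su = Su

      meets : ∀ t → t < suc m → ∃ λ c → ⋃ pieceᵥ t c ≡ true × pieceᵥ (suc t) c ≡ true ×
                                  (∀ {w} → ⋃ pieceᵥ t w ≡ true → pieceᵥ (suc t) w ≡ true → w ≡ c)
      meets t t< = c , in-earlier , in-next , unique
        where
        i : Fin K
        i = rot s (suc t)
        c : Fin N
        c = ι i (x i)
        in-next : pieceᵥ (suc t) c ≡ true
        in-next = imageᵥ⁺ (ι i) (has-x i (λ e → rot-distinct (s≤s z≤n) t< (sym e)))
        in-earlier : ⋃ pieceᵥ t c ≡ true
        in-earlier = ⋃⁺ pieceᵥ {t} {t} ≤-refl (subst (λ a → pieceᵥ t a ≡ true) (junction (rot s t))
          (imageᵥ⁺ (ι (rot s t)) (has-y (rot s t) (λ e → rot-distinct t< ≤-refl (trans e (sym rot-last))))))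
        unique : ∀ {w} → ⋃ pieceᵥ t w ≡ true → pieceᵥ (suc t) w ≡ true → w ≡ c
        unique p q with ⋃⁻ pieceᵥ p | imageᵥ⁻ (ι i) q
        ... | r , r≤t , p' | u , Su , refl with imageᵥ⁻ (ι (rot s r)) p'
        ...   | u' , Su' , e with ι-cross i (rot s r) (sym e) (λ e' → rot-distinct (s≤s r≤t) t< (sym e'))
        ...     | inj₂ (refl , _ , _) = refl
        ...     | inj₁ (refl , e'' , refl) with rot-injective s (s≤s (m≤n⇒m≤1+n r≤t)) (s≤s t<) e''
        ...       | refl , refl =
          ⊥-elim ([ true⇒≢false (x-in refl refl Su') , true⇒≢false (y-in rot-last refl Su) ] cut)

    tree-T : IsSpanningTree G U T
    tree-T = chain-tree {G = G} pieceₑ pieceᵥ (suc m)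
      (λ t _ → image-tree {H = H (rot s t)} {G} (ι (rot s t)) (ι-injective (rot s t)) (ι-edge (rot s t))
                          (tree (rot s t)))
      meets

    U⁻ : ∀ {a} → U a ≡ true → ∃ λ i → ∃ λ u → S i u ≡ true × ι i u ≡ a
    U⁻ e with ⋃⁻ pieceᵥ {suc m} e
    ... | t , _ , p with imageᵥ⁻ (ι (rot s t)) p
    ...   | u , Su , q = rot s t , u , Su , q

    U⁺ : ∀ i {u} → S i u ≡ true → U (ι i u) ≡ true
    U⁺ i Su with rot-onto s i
    ... | t , t<K , refl = ⋃⁺ pieceᵥ {t} {suc m} (s≤s⁻¹ t<K) (imageᵥ⁺ (ι (rot s t)) Su)

    T⁻ : ∀ {a b} → Edge T a b → ∃ λ i → ∃ λ u → ∃ λ w → Edge (E i) u w × ι i u ≡ a × ι i w ≡ b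
    T⁻ {a} e with ⋃⁻ (λ t → pieceₑ t a) {suc m} e
    ... | t , _ , p with imageₑ⁻ (ι (rot s t)) p
    ...   | u , w , e' , q , r = rot s t , u , w , e' , q , r

    T⁺ : ∀ i {u w} → Edge (E i) u w → Edge T (ι i u) (ι i w)
    T⁺ i {u} e with rot-onto s i
    ... | t , t<K , refl = ⋃⁺ (λ t → pieceₑ t (ι i u)) {t} {suc m} (s≤s⁻¹ t<K) (imageₑ⁺ (ι (rot s t)) e)

  inner-deg≢2 : ∀ {i} {S : VSet (n i)} {E : EdgeSet (n i)} → IsExclHIST (H i) S (Pair (x i) (y i)) E →
                ∀ {u} → Inner i u → deg E u ≢ 2
  inner-deg≢2 {i} {S} {E} h {u} inner with true-or-false (S u)
  ... | inj₁ Su = proj₂ h u Su (Inner⁻ inner)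
  ... | inj₂ Su = ≡0⇒≢2 (SpanningTree.outside-deg (H i) S E (proj₁ h) Su)

  module ChainHIST (s l : Fin K) (l→s : next l ≡ s) (E : ∀ i → EdgeSet (n i)) (S : ∀ i → VSet (n i))
                   (hist : ∀ i → IsExclHIST (H i) (S i) (Pair (x i) (y i)) (E i))
                   (has-x : ∀ i → i ≢ s → S i (x i) ≡ true)
                   (has-y : ∀ i → i ≢ l → S i (y i) ≡ true)
                   (cut : S s (x s) ≡ false ⊎ S l (y l) ≡ false)
                   (junction-ok : ∀ p → NoCollision E p × deg (E p) (y p) + deg (E (next p)) (x (next p)) ≢ 2) where

    open Chain s l l→s E S (λ i → proj₁ (hist i)) has-x has-y cut
    open Assembled E T T⁻ T⁺

    degrees : ∀ a → deg T a ≢ 2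
    degrees a with vertex-cases a
    ... | inj₁ (i , u , inner , refl) = λ d → inner-deg≢2 (hist i) inner (trans (sym (deg-inner inner)) d)
    ... | inj₂ (p , refl) = λ d → proj₂ (junction-ok p) (trans (sym (deg-junction p (proj₁ (junction-ok p)))) d)

    hist-minus : ∀ v → (∀ {i u} → S i u ≡ true → ι i u ≢ v) →
                 (∀ {a} → a ≢ v → ∃ λ i → ∃ λ u → S i u ≡ true × ι i u ≡ a) →
                 ∃ λ T → IsHIST G (minus v) T
    hist-minus v avoid cover = T , tree-resp {G = G} {T = T} U⊆ ⊆U tree-T , λ a _ _ → degrees a
      where
      U⊆ : ∀ a → U a ≡ true → minus v a ≡ true
      U⊆ a e with U⁻ {a} e
      ... | i , u , Su , refl = minus-true {z = v} (avoid Su)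
      ⊆U : ∀ a → minus v a ≡ true → U a ≡ true
      ⊆U a e with cover {a} (minus-true⁻ e)
      ... | i , u , Su , refl = U⁺ i Su

  -- The cycle is cut at the junction of l and s: H_l and H_s lose the vertices zₗ and zₛ and every
  -- other fragment keeps its excluded HIST from (1). Only one side of the cut junction survives,
  -- hence cut-deg; short-cycle-deg is needed at the other junction of s and l when K = 2.

  module Cut (s l : Fin K) (l→s : next l ≡ s)
             (zₗ : Fin (n l)) (Eₗ : EdgeSet (n l)) (histₗ : IsExclHIST (H l) (minus zₗ) (Pair (x l) (y l)) Eₗ)
             (zₛ : Fin (n s)) (Eₛ : EdgeSet (n s)) (histₛ : IsExclHIST (H s) (minus zₛ) (Pair (x s) (y s)) Eₛ)
             (zₗ≢x : zₗ ≢ x l) (zₛ≢y : zₛ ≢ y s)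
             (cut-deg : (zₗ ≡ y l × deg Eₛ (x s) ≢ 2) ⊎ (zₛ ≡ x s × deg Eₗ (y l) ≢ 2))
             (short-cycle-deg : deg Eₛ (y s) ≢ 1 ⊎ deg Eₗ (x l) ≢ 1) where

    private
      l≢s : l ≢ s
      l≢s e = next≢ l (trans l→s (sym e))

      Piece : Fin K → Set
      Piece i = EdgeSet (n i) × VSet (n i)

      family : (i : Fin K) → Piece i
      family = ((λ i → Fr.hist i , full) [ l ≔ (Eₗ , minus zₗ) ]) [ s ≔ (Eₛ , minus zₛ) ]

    E : ∀ i → EdgeSet (n i)
    E i = proj₁ (family i)

    S : ∀ i → VSet (n i)
    S i = proj₂ (family i)

    private
      family-s : family s ≡ (Eₛ , minus zₛ)
      family-s = update-same _ s _

      family-l : family l ≡ (Eₗ , minus zₗ)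
      family-l = trans (update-other _ s _ (l≢s ∘ sym)) (update-same _ l _)

      family-other : ∀ {i} → i ≢ l → i ≢ s → family i ≡ (Fr.hist i , full)
      family-other i≢l i≢s = trans (update-other _ s _ (i≢s ∘ sym)) (update-other _ l _ (i≢l ∘ sym))

      hist : ∀ i → IsExclHIST (H i) (S i) (Pair (x i) (y i)) (E i)
      hist i with i ≟ l | i ≟ s
      ... | yes refl | _ rewrite family-l = histₗ
      ... | no _ | yes refl rewrite family-s = histₛ
      ... | no i≢l | no i≢s rewrite family-other i≢l i≢s = Fr.hist-is i

      has-x : ∀ i → i ≢ s → S i (x i) ≡ true
      has-x i i≢s with i ≟ l
      ... | yes refl rewrite family-l = minus-true (zₗ≢x ∘ sym)
      ... | no i≢l rewrite family-other i≢l i≢s = refl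

      has-y : ∀ i → i ≢ l → S i (y i) ≡ true
      has-y i i≢l with i ≟ s
      ... | yes refl rewrite family-s = minus-true (zₛ≢y ∘ sym)
      ... | no i≢s rewrite family-other i≢l i≢s = refl

      lacks-y : zₗ ≡ y l → S l (y l) ≡ false
      lacks-y zₗ≡y rewrite family-l = subst (λ z → minus zₗ z ≡ false) zₗ≡y (minus-self zₗ)

      lacks-x : zₛ ≡ x s → S s (x s) ≡ false
      lacks-x zₛ≡x rewrite family-s = subst (λ z → minus zₛ z ≡ false) zₛ≡x (minus-self zₛ)

      cut : S s (x s) ≡ false ⊎ S l (y l) ≡ false
      cut = ⊎-map (lacks-x ∘ proj₁) (lacks-y ∘ proj₁) (swap cut-deg)

      roomy : ∀ i c → ∃ λ w → S i w ≡ true × w ≢ c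
      roomy i c with i ≟ l | i ≟ s
      ... | yes refl | _ rewrite family-l = let (w , w≢z , w≢c) = Fr.another l zₗ c in w , minus-true w≢z , w≢c
      ... | no _ | yes refl rewrite family-s = let (w , w≢z , w≢c) = Fr.another s zₛ c in w , minus-true w≢z , w≢c
      ... | no i≢l | no i≢s rewrite family-other i≢l i≢s = let (w , w≢c , _) = Fr.another i c c in w , refl , w≢c

      module Tr (i : Fin K) = SpanningTree (H i) (S i) (E i) (proj₁ (hist i))

      present-deg≢0 : ∀ i {u} → S i u ≡ true → deg (E i) u ≢ 0
      present-deg≢0 i {u} Su with roomy i u
      ... | w , Sw , w≢u = deg≢0 {T = E i} (proj₂ (Tr.neighbour i Su Sw (w≢u ∘ sym)))

      untouched-deg≢1 : ∀ {i} → i ≢ l → i ≢ s → ∀ {u} → Pair (x i) (y i) u → deg (E i) u ≢ 1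
      untouched-deg≢1 {i} i≢l i≢s (inj₁ refl) rewrite family-other i≢l i≢s = ≡2⇒≢1 (Fr.hist-deg-x i)
      untouched-deg≢1 {i} i≢l i≢s (inj₂ refl) rewrite family-other i≢l i≢s = ≡2⇒≢1 (Fr.hist-deg-y i)

      deg-Eₗ : ∀ u → deg (E l) u ≡ deg Eₗ u
      deg-Eₗ u = cong (λ c → deg (proj₁ c) u) family-l

      deg-Eₛ : ∀ u → deg (E s) u ≡ deg Eₛ u
      deg-Eₛ u = cong (λ c → deg (proj₁ c) u) family-s

      at-cut : NoCollision E l × deg (E l) (y l) + deg (E (next l)) (x (next l)) ≢ 2
      at-cut = subst (λ j → (∀ {w w'} → Edge (E l) (y l) w → Edge (E j) (x j) w' → ι l w ≢ ι j w') ×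
                            deg (E l) (y l) + deg (E j) (x j) ≢ 2)
                     (sym l→s) ([ y-removed , x-removed ]′ cut-deg)
        where
        y-removed : zₗ ≡ y l × deg Eₛ (x s) ≢ 2 →
                    (∀ {w w'} → Edge (E l) (y l) w → Edge (E s) (x s) w' → ι l w ≢ ι s w') ×
                    deg (E l) (y l) + deg (E s) (x s) ≢ 2
        y-removed (zₗ≡y , d) =
          (λ {w} e _ _ → true⇒≢false e (isolated w)) ,
          λ sum → d (trans (sym (deg-Eₛ (x s)))
                           (trans (cong (_+ deg (E s) (x s)) (sym (deg-none {T = E l} {y l} isolated))) sum))
          where
          isolated : ∀ w → E l (y l) w ≡ false
          isolated = Tr.outside-isolated l (lacks-y zₗ≡y)
        x-removed : zₛ ≡ x s × deg Eₗ (y l) ≢ 2 →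
                    (∀ {w w'} → Edge (E l) (y l) w → Edge (E s) (x s) w' → ι l w ≢ ι s w') ×
                    deg (E l) (y l) + deg (E s) (x s) ≢ 2
        x-removed (zₛ≡x , d) =
          (λ {_} {w'} _ e' _ → true⇒≢false e' (isolated w')) ,
          λ sum → d (trans (sym (deg-Eₗ (y l)))
                           (trans (sym (+-identityʳ _))
                                  (trans (cong (deg (E l) (y l) +_) (sym (deg-none {T = E s} {x s} isolated))) sum)))
          where
          isolated : ∀ w → E s (x s) w ≡ false
          isolated = Tr.outside-isolated s (lacks-x zₛ≡x)

      inner-deg≢1 : ∀ p → p ≢ l → deg (E p) (y p) ≢ 1 ⊎ deg (E (next p)) (x (next p)) ≢ 1
      inner-deg≢1 p p≢l with p ≟ s
      ... | no p≢s = inj₁ (untouched-deg≢1 p≢l p≢s (inj₂ refl))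
      ... | yes refl with next s ≟ l
      ...   | no ns≢l = inj₂ (untouched-deg≢1 ns≢l (next≢ s) (inj₁ refl))
      ...   | yes ns≡l = ⊎-map (λ d e → d (trans (sym (deg-Eₛ (y s))) e))
                                      (λ d → subst (λ j → deg (E j) (x j) ≢ 1) (sym ns≡l)
                                                   (λ e → d (trans (sym (deg-Eₗ (x l))) e)))
                                      short-cycle-deg

      inner-no-collision : ∀ p → p ≢ l → NoCollision E p
      inner-no-collision p p≢l = no-collision E p (Tr.no-loop p) alt
        where
        alt : next (next p) ≢ p ⊎ ¬ Edge (E p) (y p) (x p) ⊎ ¬ Edge (E (next p)) (x (next p)) (y (next p))
        alt with next (next p) ≟ p
        ... | no nnp≢p = inj₁ nnp≢p
        ... | yes nnp≡p with two-indices p nnp≡p l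
        ...   | inj₁ l≡p = ⊥-elim (p≢l (sym l≡p))
        ...   | inj₂ l≡np with trans (trans (sym l→s) (cong next l≡np)) nnp≡p
        ...     | refl = inj₂ (⊎-map (λ Sx e → true⇒≢false (proj₂ (Tr.edge-in s e)) Sx)
                                          (λ Sy → subst (λ j → ¬ Edge (E j) (x j) (y j)) l≡np
                                                        (λ e → true⇒≢false (proj₂ (Tr.edge-in l e)) Sy))
                                          cut)

      junction-ok : ∀ p → NoCollision E p × deg (E p) (y p) + deg (E (next p)) (x (next p)) ≢ 2
      junction-ok p with p ≟ l
      ... | yes refl = at-cut
      ... | no p≢l = inner-no-collision p p≢l ,
                     +≢2 (present-deg≢0 p (has-y p p≢l))
                         (present-deg≢0 (next p) (has-x (next p) (λ e → p≢l (next-injective (trans e (sym l→s))))))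
                         (inner-deg≢1 p p≢l)

      removed : ∀ {i u} → S i u ≡ false →
                (Σ (Fin K) (Fin ∘ n) ∋ (i , u)) ≡ (l , zₗ) ⊎ (Σ (Fin K) (Fin ∘ n) ∋ (i , u)) ≡ (s , zₛ)
      removed {i} {u} Su with i ≟ l | i ≟ s
      ... | yes refl | _ with minus-false⁻ {z = zₗ} {u} (subst (λ c → proj₂ c u ≡ false) family-l Su)
      ...   | refl = inj₁ refl
      removed {i} {u} Su | no _ | yes refl with minus-false⁻ {z = zₛ} {u} (subst (λ c → proj₂ c u ≡ false) family-s Su)
      ...   | refl = inj₂ refl
      removed {i} {u} Su | no i≢l | no i≢s =
        ⊥-elim (true⇒≢false refl (subst (λ c → proj₂ c u ≡ false) (family-other i≢l i≢s) Su))

      S-zₗ : S l zₗ ≡ false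
      S-zₗ rewrite family-l = minus-self zₗ

      S-zₛ : S s zₛ ≡ false
      S-zₛ rewrite family-s = minus-self zₛ

      S-x : x s ≢ zₛ → S s (x s) ≡ true
      S-x x≢z rewrite family-s = minus-true x≢z

      S-y : y l ≢ zₗ → S l (y l) ≡ true
      S-y y≢z rewrite family-l = minus-true y≢z

      junction-cut : ι l (y l) ≡ ι s (x s)
      junction-cut = trans (junction l) (cong (λ j → ι j (x j)) l→s)

      module CH = ChainHIST s l l→s E S hist has-x has-y cut junction-ok

    hist-minus : ∀ v →
      (∀ {i u} → ι i u ≡ v → (Σ (Fin K) (Fin ∘ n) ∋ (i , u)) ≡ (l , zₗ) ⊎ (Σ (Fin K) (Fin ∘ n) ∋ (i , u)) ≡ (s , zₛ)) →
      ι l zₗ ≡ v ⊎ (zₗ ≡ y l × zₛ ≢ x s) →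
      ι s zₛ ≡ v ⊎ (zₛ ≡ x s × zₗ ≢ y l) →
      ∃ λ T → IsHIST G (minus v) T
    hist-minus v preimage l-gone s-gone = CH.hist-minus v avoid cover
      where
      avoid : ∀ {i u} → S i u ≡ true → ι i u ≢ v
      avoid Su e with preimage e
      ... | inj₁ refl = true⇒≢false Su S-zₗ
      ... | inj₂ refl = true⇒≢false Su S-zₛ
      cover : ∀ {a} → a ≢ v → ∃ λ i → ∃ λ u → S i u ≡ true × ι i u ≡ a
      cover {a} a≢v with ι-onto a
      ... | (i , u) , refl with true-or-false (S i u)
      ...   | inj₁ Su = i , u , Su , refl
      ...   | inj₂ Su with removed Su
      ...     | inj₁ refl = [ (λ e → ⊥-elim (a≢v e)) ,
                              (λ (zₗ≡y , zₛ≢x) → s , x s , S-x (zₛ≢x ∘ sym) ,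
                                                   sym (trans (cong (ι l) zₗ≡y) junction-cut)) ] l-gone
      ...     | inj₂ refl = [ (λ e → ⊥-elim (a≢v e)) ,
                              (λ (zₛ≡x , zₗ≢y) → l , y l , S-y (zₗ≢y ∘ sym) ,
                                                   trans junction-cut (cong (ι s) (sym zₛ≡x))) ] s-gone

  private
    removed-deg≢2 : ∀ {i} {z : Fin (n i)} {E} → IsExclHIST (H i) (minus z) (Pair (x i) (y i)) E → deg E z ≢ 2
    removed-deg≢2 {i} {z} {E} h = ≡0⇒≢2 (SpanningTree.outside-deg (H i) (minus z) E (proj₁ h) (minus-self z))

  junction-removal : ∀ p → ∃ λ T → IsHIST G (minus (ι p (y p))) T
  junction-removal p =
    Cut.hist-minus (next p) p refl (y p) (Fr.hist-y p) (Fr.hist-y-is p)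
      (x (next p)) (Fr.hist-x (next p)) (Fr.hist-x-is (next p)) (Fr.x≢y p ∘ sym) (Fr.x≢y (next p))
      (inj₁ (refl , removed-deg≢2 (Fr.hist-x-is (next p)))) (inj₁ (Fr.hist-x-deg (next p)))
      (ι p (y p)) (at-junction p) (inj₁ refl) (inj₁ (sym (junction p)))

  inner-removal-x : ∀ {j v} → Inner j v → ∀ {T₀} → IsExclHIST (H j) (minus v) (Pair (x j) (y j)) T₀ → deg T₀ (x j) ≢ 2 →
                    ∃ λ T → IsHIST G (minus (ι j v)) T
  inner-removal-x {j} {v} inner {T₀} h d =
    Cut.hist-minus j l (next-prev j) (y l) (Fr.hist-y l) (Fr.hist-y-is l) v T₀ h
      (Fr.x≢y l ∘ sym) (proj₂ inner) (inj₁ (refl , d)) (inj₂ (Fr.hist-y-deg l))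
      (ι j v) (λ e → inj₂ (sym (inner-unique inner (sym e)))) (inj₂ (refl , proj₁ inner)) (inj₁ refl)
    where l = prev j

  inner-removal-y : ∀ {j v} → Inner j v → ∀ {T₀} → IsExclHIST (H j) (minus v) (Pair (x j) (y j)) T₀ → deg T₀ (y j) ≢ 2 →
                    ∃ λ T → IsHIST G (minus (ι j v)) T
  inner-removal-y {j} {v} inner {T₀} h d =
    Cut.hist-minus (next j) j refl v T₀ h (x (next j)) (Fr.hist-x (next j)) (Fr.hist-x-is (next j))
      (proj₁ inner) (Fr.x≢y (next j)) (inj₂ (refl , d)) (inj₁ (Fr.hist-x-deg (next j)))
      (ι j v) (λ e → inj₁ (sym (inner-unique inner (sym e)))) (inj₁ refl) (inj₂ (refl , proj₂ inner))

  -- The y-side of the split fragment j starts the chain at y_j and the x-side closes it at x_j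

  module Split {j v} (inner : Inner j v) {T₀ : EdgeSet (n j)} (h : IsTwoCompHISF (H j) (minus v) (x j) (y j) T₀) where

    private
      l : Fin K
      l = prev j

      l≢j : l ≢ j
      l≢j e = next≢ l (trans (next-prev j) (sym e))

      forest : IsSpanningForest (H j) (minus v) T₀
      forest = proj₁ h

      inner-degrees : ∀ u → minus v u ≡ true → ¬ Pair (x j) (y j) u → deg T₀ u ≢ 2
      inner-degrees = proj₁ (proj₂ h)

      separated : ¬ Conn T₀ (x j) (y j)
      separated = proj₁ (proj₂ (proj₂ h))

      reach : ∀ u → minus v u ≡ true → Conn T₀ (x j) u ⊎ Conn T₀ (y j) u
      reach = proj₁ (proj₂ (proj₂ (proj₂ h)))

      x-attached : ∃ (Edge T₀ (x j))
      x-attached = proj₁ (proj₂ (proj₂ (proj₂ (proj₂ h))))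

      y-attached : ∃ (Edge T₀ (y j))
      y-attached = proj₂ (proj₂ (proj₂ (proj₂ (proj₂ h))))

      undirected : Undirected T₀
      undirected = proj₁ forest

      inside : ∀ {u w} → Edge T₀ u w → Edge (adj (H j)) u w × minus v u ≡ true × minus v w ≡ true
      inside = proj₁ (proj₂ forest) _ _

      module Cx = Component (H j) (minus v) T₀ (x j) (y j) forest reach separated (minus-true (proj₁ inner ∘ sym))
      module Cy = Component (H j) (minus v) T₀ (y j) (x j) forest (λ u Su → swap (reach u Su))
                              (separated ∘ walk-reverse undirected) (minus-true (proj₂ inner ∘ sym))

      sides-disjoint : ∀ {u} → Cy.part u ≡ true → Cx.part u ≡ true → ⊥
      sides-disjoint py px = separated (proj₂ (Cx.part⁻ px) ◅◅ walk-reverse undirected (proj₂ (Cy.part⁻ py)))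

      sides-cover : ∀ {u} → minus v u ≡ true → Cy.part u ≡ false → Cx.part u ≡ true
      sides-cover Su f = Cx.part⁺ Su (Cy.part-false⁻ Su f)

      Piece : Fin K → Set
      Piece i = EdgeSet (n i) × VSet (n i)

      family : (i : Fin K) → Piece i
      family = (λ i → Fr.hist i , full) [ j ≔ (Cy.partₑ , Cy.part) ]

      family-j : family j ≡ (Cy.partₑ , Cy.part)
      family-j = update-same _ j _

      family-other : ∀ {i} → i ≢ j → family i ≡ (Fr.hist i , full)
      family-other i≢j = update-other _ j _ (i≢j ∘ sym)

      E : ∀ i → EdgeSet (n i)
      E i = proj₁ (family i)

      S : ∀ i → VSet (n i)
      S i = proj₂ (family i)

      tree : ∀ i → IsSpanningTree (H i) (S i) (E i)
      tree i with i ≟ j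
      ... | yes refl rewrite family-j = Cy.part-tree
      ... | no i≢j rewrite family-other i≢j = proj₁ (Fr.hist-is i)

      has-x : ∀ i → i ≢ j → S i (x i) ≡ true
      has-x i i≢j rewrite family-other i≢j = refl

      has-y : ∀ i → S i (y i) ≡ true
      has-y i with i ≟ j
      ... | yes refl rewrite family-j = Cy.part-c
      ... | no i≢j rewrite family-other i≢j = refl

      lacks-x : S j (x j) ≡ false
      lacks-x rewrite family-j = Cy.part-c'

      module Ch = Chain j l (next-prev j) E S tree has-x (λ i _ → has-y i) (inj₁ lacks-x)

      Xₑ : EdgeSet N
      Xₑ = imageₑ (ι j) Cx.partₑ

      Xᵥ : VSet N
      Xᵥ = imageᵥ (ι j) Cx.part

      c : Fin N
      c = ι j (x j)

      c-in-chain : Ch.U c ≡ true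
      c-in-chain = subst (λ a → Ch.U a ≡ true) (trans (junction l) (cong (λ i → ι i (x i)) (next-prev j)))
                         (Ch.U⁺ l (has-y l))

      meet : ∀ {w} → Ch.U w ≡ true → Xᵥ w ≡ true → w ≡ c
      meet {w} p q with Ch.U⁻ {w} p | imageᵥ⁻ (ι j) {Cx.part} {w} q
      ... | i , u , Su , e | u' , pu' , refl with i ≟ j
      ...   | yes refl with ι-injective j e
      ...     | refl = ⊥-elim (sides-disjoint (subst (λ c → proj₂ c u ≡ true) family-j Su) pu')
      meet p q | i , u , Su , e | u' , pu' , refl | no i≢j with ι-cross j i (sym e) (i≢j ∘ sym)
      ...     | inj₁ (refl , _ , _) = ⊥-elim (true⇒≢false pu' Cx.part-c')
      ...     | inj₂ (refl , _ , _) = refl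

      Tₑ : EdgeSet N
      Tₑ = Ch.T ∪ₑ Xₑ

      tree-T : IsSpanningTree G (Ch.U ∪ᵥ Xᵥ) Tₑ
      tree-T = tree-∪ {G = G} {Ch.T} {Xₑ} {Ch.U} {Xᵥ} {c} Ch.tree-T
                      (image-tree {H = H j} {G} (ι j) (ι-injective j) (ι-edge j) Cx.part-tree) c-in-chain
                      (imageᵥ⁺ (ι j) Cx.part-c) meet

      E' : ∀ i → EdgeSet (n i)
      E' = (λ i → Fr.hist i) [ j ≔ T₀ ]

      E'-j : E' j ≡ T₀
      E'-j = update-same _ j _

      E'-other : ∀ {i} → i ≢ j → E' i ≡ Fr.hist i
      E'-other i≢j = update-other _ j _ (i≢j ∘ sym)

      E⊆E' : ∀ i {u w} → Edge (E i) u w → Edge (E' i) u w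
      E⊆E' i {u} {w} e with i ≟ j
      ... | yes refl rewrite E'-j = ∧-conicalˡ _ _ (subst (λ c → proj₁ c u w ≡ true) family-j e)
      ... | no i≢j rewrite E'-other i≢j = subst (λ c → proj₁ c u w ≡ true) (family-other i≢j) e

      from : ∀ {a b} → Edge Tₑ a b → ∃ λ i → ∃ λ u → ∃ λ w → Edge (E' i) u w × ι i u ≡ a × ι i w ≡ b
      from {a} {b} e with ∨-true⁻ {Ch.T a b} e
      ... | inj₁ p = let (i , u , w , e' , q , r) = Ch.T⁻ p in i , u , w , E⊆E' i e' , q , r
      ... | inj₂ p = let (u , w , e' , q , r) = imageₑ⁻ (ι j) p in
                     j , u , w , subst (λ T → Edge T u w) (sym E'-j) (∧-conicalˡ _ _ e') , q , r

      to : ∀ i {u w} → Edge (E' i) u w → Edge Tₑ (ι i u) (ι i w)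
      to i {u} {w} e with i ≟ j
      ... | no i≢j = ∨-trueˡ _ (Ch.T⁺ i (subst (λ c → proj₁ c u w ≡ true) (sym (family-other i≢j))
                                               (subst (λ T → Edge T u w) (E'-other i≢j) e)))
      ... | yes refl with subst (λ T → Edge T u w) E'-j e | true-or-false (Cy.part u)
      ...   | e' | inj₁ py = ∨-trueˡ _ (Ch.T⁺ j (subst (λ c → proj₁ c u w ≡ true) (sym family-j) (∧-true e' py)))
      ...   | e' | inj₂ py = ∨-trueʳ (Ch.T (ι j u) (ι j w))
                                     (imageₑ⁺ (ι j) (∧-true e' (sides-cover (proj₁ (proj₂ (inside e'))) py)))

      open Assembled E' Tₑ from to

      T₀-no-xy : ¬ Edge T₀ (x j) (y j)
      T₀-no-xy e = separated (e ◅ ε)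

      T₀-deg≢0 : ∀ {u} → ∃ (Edge T₀ u) → deg T₀ u ≢ 0
      T₀-deg≢0 (_ , e) = deg≢0 {T = T₀} e

      hist-deg≢0 : ∀ {i} → i ≢ j → ∀ {u} → Pair (x i) (y i) u → deg (E' i) u ≢ 0
      hist-deg≢0 {i} i≢j (inj₁ refl) rewrite E'-other i≢j = ≡2⇒≢0 (Fr.hist-deg-x i)
      hist-deg≢0 {i} i≢j (inj₂ refl) rewrite E'-other i≢j = ≡2⇒≢0 (Fr.hist-deg-y i)

      hist-deg≢1 : ∀ {i} → i ≢ j → ∀ {u} → Pair (x i) (y i) u → deg (E' i) u ≢ 1
      hist-deg≢1 {i} i≢j (inj₁ refl) rewrite E'-other i≢j = ≡2⇒≢1 (Fr.hist-deg-x i)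
      hist-deg≢1 {i} i≢j (inj₂ refl) rewrite E'-other i≢j = ≡2⇒≢1 (Fr.hist-deg-y i)

      no-loop : ∀ i {u} → ¬ Edge (E' i) u u
      no-loop i {u} e with i ≟ j
      ... | yes refl = true⇒≢false (proj₁ (inside (subst (λ T → Edge T u u) E'-j e))) (loopless (H j) u)
      ... | no i≢j =
        SpanningTree.no-loop (H i) full (Fr.hist i) (proj₁ (Fr.hist-is i)) (subst (λ T → Edge T u u) (E'-other i≢j) e)

      inner-deg : ∀ {i u} → Inner i u → deg (E' i) u ≢ 2
      inner-deg {i} {u} inner' with i ≟ j
      ... | no i≢j rewrite E'-other i≢j = proj₂ (Fr.hist-is i) u refl (Inner⁻ inner')
      ... | yes refl rewrite E'-j with true-or-false (minus v u)
      ...   | inj₁ Su = inner-degrees u Su (Inner⁻ inner')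
      ...   | inj₂ Su = ≡0⇒≢2 (deg-none {T = T₀} {u} λ w → ¬true⇒false λ e → true⇒≢false (proj₁ (proj₂ (inside e))) Su)

      junction-ok : ∀ p → NoCollision E' p × deg (E' p) (y p) + deg (E' (next p)) (x (next p)) ≢ 2
      junction-ok p with p ≟ l | p ≟ j
      ... | yes refl | _ =
        no-collision E' l (no-loop l) (inj₂ (inj₂ (subst (λ i → ¬ Edge (E' i) (x i) (y i)) (sym (next-prev j))
                                                       (subst (λ T → ¬ Edge T (x j) (y j)) (sym E'-j) T₀-no-xy)))) ,
        +≢2 (hist-deg≢0 l≢j (inj₂ refl))
            (subst (λ i → deg (E' i) (x i) ≢ 0) (sym (next-prev j))
                   (subst (λ T → deg T (x j) ≢ 0) (sym E'-j) (T₀-deg≢0 x-attached)))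
            (inj₁ (hist-deg≢1 l≢j (inj₂ refl)))
      ... | no _ | yes refl =
        no-collision E' j (no-loop j)
          (inj₂ (inj₁ (subst (λ T → ¬ Edge T (y j) (x j)) (sym E'-j) (T₀-no-xy ∘ edge-sym undirected)))) ,
        +≢2 (subst (λ T → deg T (y j) ≢ 0) (sym E'-j) (T₀-deg≢0 y-attached)) (hist-deg≢0 (next≢ j) (inj₁ refl))
            (inj₂ (hist-deg≢1 (next≢ j) (inj₁ refl)))
      ... | no p≢l | no p≢j =
        no-collision E' p (no-loop p) (inj₁ short) ,
        +≢2 (hist-deg≢0 p≢j (inj₂ refl)) (hist-deg≢0 np≢j (inj₁ refl)) (inj₁ (hist-deg≢1 p≢j (inj₂ refl)))
        where
        np≢j : next p ≢ j
        np≢j e = p≢l (next-injective (trans e (sym (next-prev j))))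
        short : next (next p) ≢ p
        short e with two-indices p e j
        ... | inj₁ j≡p = p≢j (sym j≡p)
        ... | inj₂ j≡np = np≢j (sym j≡np)

      degrees : ∀ a → deg Tₑ a ≢ 2
      degrees a with vertex-cases a
      ... | inj₁ (i , u , inner' , refl) = λ d → inner-deg inner' (trans (sym (deg-inner inner')) d)
      ... | inj₂ (p , refl) = λ d → proj₂ (junction-ok p) (trans (sym (deg-junction p (proj₁ (junction-ok p)))) d)

      spans : ∀ a → (Ch.U ∪ᵥ Xᵥ) a ≡ true → minus (ι j v) a ≡ true
      spans a e with ∨-true⁻ {Ch.U a} e
      ... | inj₁ p with Ch.U⁻ p
      ...   | i , u , Su , refl = minus-true λ q → case (inner-unique inner (sym q)) Su
        where
        case : (Σ (Fin K) (Fin ∘ n) ∋ (j , v)) ≡ (i , u) → S i u ≡ true → ⊥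
        case refl Sv = true⇒≢false (proj₁ (Cy.part⁻ (subst (λ c → proj₂ c v ≡ true) family-j Sv))) (minus-self v)
      spans a e | inj₂ p with imageᵥ⁻ (ι j) p
      ...   | u , pu , refl = minus-true λ q →
        true⇒≢false (proj₁ (Cx.part⁻ pu)) (subst (λ w → minus v w ≡ false) (sym (ι-injective j q)) (minus-self v))

      spanned : ∀ a → minus (ι j v) a ≡ true → (Ch.U ∪ᵥ Xᵥ) a ≡ true
      spanned a e with ι-onto a
      ... | (i , u) , refl with i ≟ j
      ...   | no i≢j = ∨-trueˡ _ (Ch.U⁺ i (subst (λ c → proj₂ c u ≡ true) (sym (family-other i≢j)) refl))
      ...   | yes refl with true-or-false (Cy.part u)
      ...     | inj₁ py = ∨-trueˡ _ (Ch.U⁺ j (subst (λ c → proj₂ c u ≡ true) (sym family-j) py))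
      ...     | inj₂ py =
        ∨-trueʳ (Ch.U (ι j u)) (imageᵥ⁺ (ι j) (sides-cover (minus-true (λ u≡v → minus-true⁻ e (cong (ι j) u≡v))) py))

    hist-minus : ∃ λ T → IsHIST G (minus (ι j v)) T
    hist-minus = Tₑ , tree-resp {G = G} {T = Tₑ} spans spanned tree-T , λ a _ _ → degrees a

  removal : ∀ a → ∃ λ T → IsHIST G (minus a) T
  removal a with vertex-cases a
  ... | inj₂ (p , refl) = junction-removal p
  ... | inj₁ (j , v , inner , refl) with Fr.inner-removal j v (proj₁ inner) (proj₂ inner)
  ...   | inj₁ (_ , h , inj₁ dx) = inner-removal-x inner h dx
  ...   | inj₁ (_ , h , inj₂ dy) = inner-removal-y inner h dy
  ...   | inj₂ (_ , h) = Split.hist-minus inner h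

  -- G has no HIST

  module NoHIST (T : EdgeSet N) (hist : IsHIST G full T) where

    private
      module TT = SpanningTree G full T (proj₁ hist)

      T-deg : ∀ a → deg T a ≢ 2
      T-deg a = proj₂ hist a refl (λ ())

    R : ∀ i → EdgeSet (n i)
    R i u w = T (ι i u) (ι i w) ∧ adj (H i) u w

    R→T : ∀ i {u w} → Edge (R i) u w → Edge T (ι i u) (ι i w)
    R→T i {u} {w} = ∧-conicalˡ (T (ι i u) (ι i w)) _

    T→R : ∀ {a b} → Edge T a b → ∃ λ i → ∃ λ u → ∃ λ w → Edge (R i) u w × ι i u ≡ a × ι i w ≡ b
    T→R e with edge-source (TT.edge-adj e)
    ... | i , u , w , h , refl , refl = i , u , w , ∧-true e h , refl , refl

    open Assembled R T T→R R→T

    R-forest : ∀ i → IsSpanningForest (H i) full (R i)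
    R-forest i = undirected , (λ u w e → ∧-conicalʳ (T (ι i u) (ι i w)) _ e , refl , refl) , acyclic
      where
      undirected : Undirected (R i)
      undirected u w = cong₂ _∧_ (TT.undirected (ι i u) (ι i w)) (Graph.sym (H i) u w)
      acyclic : Acyclic (R i)
      acyclic u w e walk = TT.acyclic (ι i u) (ι i w) (R→T i e) (Star.gmap (ι i) step walk)
        where
        step : ∀ {c d} → Edge (deleteEdge (R i) u w) c d → Edge (deleteEdge T (ι i u) (ι i w)) (ι i c) (ι i d)
        step e' with deleteEdge⁻ {T = R i} {u} {w} e'
        ... | r , ¬uw , ¬wu = deleteEdge⁺ {T = T} (R→T i r) (λ (p , q) → ¬uw (ι-injective i p , ι-injective i q))
                                                          (λ (p , q) → ¬wu (ι-injective i p , ι-injective i q))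

    R-no-loop : ∀ i {u} → ¬ Edge (R i) u u
    R-no-loop i {u} e = true⇒≢false (∧-conicalʳ (T (ι i u) (ι i u)) _ e) (loopless (H i) u)

    private
      stay-or-leave : ∀ i {a b} → Conn T a b → ∀ {u} → ι i u ≡ a →
                      (Conn (R i) u (x i) ⊎ Conn (R i) u (y i)) ⊎ (∃ λ w → ι i w ≡ b × Conn (R i) u w)
      stay-or-leave i ε {u} p = inj₂ (u , p , ε)
      stay-or-leave i (e ◅ walk) {u} p with u ≟ x i | u ≟ y i
      ... | yes refl | _ = inj₁ (inj₁ ε)
      ... | no _ | yes refl = inj₁ (inj₂ ε)
      ... | no u≢x | no u≢y with T→R (subst (λ a → Edge T a _) (sym p) e)
      ...   | l , u' , w , r , q , refl with inner-unique (u≢x , u≢y) (sym q)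
      ...     | refl = ⊎-map (⊎-map (r ◅_) (r ◅_)) (λ (w' , q' , walk') → w' , q' , r ◅ walk') (stay-or-leave i walk refl)

    rooted : ∀ i v → Conn (R i) (x i) v ⊎ Conn (R i) (y i) v
    rooted i v with Fr.another (next i) (x (next i)) (y (next i))
    ... | z , z≢x , z≢y with stay-or-leave i (TT.connected {ι i v} {ι (next i) z} refl refl) refl
    ...   | inj₁ (inj₁ walk) = inj₁ (walk-reverse (proj₁ (R-forest i)) walk)
    ...   | inj₁ (inj₂ walk) = inj₂ (walk-reverse (proj₁ (R-forest i)) walk)
    ...   | inj₂ (w , q , _) = ⊥-elim (next≢ i (,-injectiveˡ (inner-unique (z≢x , z≢y) (sym q))))

    R-inner-deg : ∀ i v → ¬ Pair (x i) (y i) v → deg (R i) v ≢ 2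
    R-inner-deg i v ¬xy d = T-deg (ι i v) (trans (deg-inner (Inner⁺ ¬xy)) d)

    module RF (i : Fin K) = RootedForest (H i) (x i) (y i) (frag i) (R i) (R-forest i) (R-inner-deg i) (rooted i)

    Isolated : ∀ i → Fin (n i) → Set
    Isolated i u = ∀ w → R i u w ≡ false

    attached? : ∀ i u → Dec (∃ (Edge (R i) u))
    attached? i u = any? λ w → R i u w ≟ᵇ true

    isolated-or-attached : ∀ i u → Isolated i u ⊎ ∃ (Edge (R i) u)
    isolated-or-attached i u with attached? i u
    ... | yes attached = inj₂ attached
    ... | no ¬attached = inj₁ λ w → ¬true⇒false λ e → ¬attached (w , e)

    some-isolated-or-all-attached : (c : ∀ i → Fin (n i)) → (∃ λ i → Isolated i (c i)) ⊎ (∀ i → ∃ (Edge (R i) (c i)))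
    some-isolated-or-all-attached c with all? (λ i → attached? i (c i))
    ... | yes all-attached = inj₂ all-attached
    ... | no ¬all with ¬∀⟶∃¬ K _ (λ i → attached? i (c i)) ¬all
    ...   | i , ¬attached = inj₁ (i , λ w → ¬true⇒false λ e → ¬attached (w , e))

    isolated-deg : ∀ {i u} → Isolated i u → deg (R i) u ≡ 0
    isolated-deg {i} {u} = deg-none {T = R i} {u}

    private
      junction-deg≢0 : ∀ p → deg T (ι p (y p)) ≢ 0
      junction-deg≢0 p =
        deg≢0 {T = T} (proj₂ (TT.neighbour {ι p (y p)} {ι p (x p)} refl refl (Fr.x≢y p ∘ sym ∘ ι-injective p)))

      junction-deg : ∀ p → Isolated p (y p) ⊎ Isolated (next p) (x (next p)) →
                     deg T (ι p (y p)) ≡ deg (R p) (y p) + deg (R (next p)) (x (next p))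
      junction-deg p iso = deg-junction p (no-collision-isolated R p iso)

      attached⇒¬¬deg2 : ∀ p → ∃ (Edge (R p) (x p)) → ∃ (Edge (R p) (y p)) →
                        ¬ ¬ (deg (R p) (x p) ≡ 2 × deg (R p) (y p) ≡ 2)
      attached⇒¬¬deg2 p ax ay k = RF.attached⇒¬¬linked p ax ay (k ∘ Fr.hist-degrees p (R p) ∘ RF.linked⇒hist p)

    x-isolation-back : ∀ p → Isolated (next p) (x (next p)) → Isolated p (x p)
    x-isolation-back p iso-x' with isolated-or-attached p (x p)
    ... | inj₁ iso-x = iso-x
    ... | inj₂ ax with isolated-or-attached p (y p)
    ...   | inj₁ iso-y = ⊥-elim (junction-deg≢0 p (trans (junction-deg p (inj₁ iso-y))
                                                          (cong₂ _+_ (isolated-deg iso-y) (isolated-deg iso-x'))))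
    ...   | inj₂ ay = ⊥-elim (attached⇒¬¬deg2 p ax ay λ (_ , dy) →
                        T-deg (ι p (y p)) (trans (junction-deg p (inj₂ iso-x'))
                                                 (cong₂ _+_ dy (isolated-deg iso-x'))))

    y-isolation-forward : ∀ p → Isolated p (y p) → Isolated (next p) (y (next p))
    y-isolation-forward p iso-y with isolated-or-attached (next p) (y (next p))
    ... | inj₁ iso-y' = iso-y'
    ... | inj₂ ay with isolated-or-attached (next p) (x (next p))
    ...   | inj₁ iso-x = ⊥-elim (junction-deg≢0 p (trans (junction-deg p (inj₁ iso-y))
                                                          (cong₂ _+_ (isolated-deg iso-y) (isolated-deg iso-x))))
    ...   | inj₂ ax = ⊥-elim (attached⇒¬¬deg2 (next p) ax ay λ (dx , _) →
                        T-deg (ι p (y p)) (trans (junction-deg p (inj₁ iso-y))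
                                                 (cong₂ _+_ (isolated-deg iso-y) dx)))

    x-isolation-everywhere : ∀ j → Isolated j (x j) → ∀ i → Isolated i (x i)
    x-isolation-everywhere j iso i with rot-onto i j
    ... | t , _ , refl = back t iso
      where
      back : ∀ t → Isolated (rot i t) (x (rot i t)) → Isolated i (x i)
      back zero iso' = iso'
      back (suc t) iso' = back t (x-isolation-back (rot i t) iso')

    y-isolation-everywhere : ∀ j → Isolated j (y j) → ∀ i → Isolated i (y i)
    y-isolation-everywhere j iso i with rot-onto j i
    ... | t , _ , refl = forward t
      where
      forward : ∀ t → Isolated (rot j t) (y (rot j t))
      forward zero = iso
      forward (suc t) = y-isolation-forward (rot j t) (forward t)

    -- If every c_i is isolated, the vertices of H₀ - c₀ are closed under T-edges

    module Separated (c : ∀ i → Fin (n i)) (isolated : ∀ i → Isolated i (c i))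
                     (outside : ∀ {l u} → l ≢ zero → u ≢ c l → imageᵥ (ι zero) (minus (c zero)) (ι l u) ≡ false)
                     (u₀ : Fin (n zero)) (u₀≢c : u₀ ≢ c zero) (u₁ : Fin (n (next zero))) (u₁≢c : u₁ ≢ c (next zero)) where

      private
        A : VSet N
        A = imageᵥ (ι zero) (minus (c zero))

        avoids-c : ∀ l {u w} → Edge (R l) u w → u ≢ c l
        avoids-c l {w = w} e refl = true⇒≢false e (isolated l w)

        closed : ∀ {a b} → Edge T a b → A a ≡ true → A b ≡ true
        closed e Aa with T→R e
        ... | l , u , w , r , refl , refl with l ≟ zero
        ...   | yes refl = imageᵥ⁺ (ι zero) (minus-true (avoids-c zero (edge-sym (proj₁ (R-forest zero)) r)))
        ...   | no l≢0 = ⊥-elim (true⇒≢false Aa (outside l≢0 (avoids-c l r)))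

        closed-walk : ∀ {a b} → Conn T a b → A a ≡ true → A b ≡ true
        closed-walk ε Aa = Aa
        closed-walk (e ◅ walk) Aa = closed-walk walk (closed e Aa)

      disconnected : ⊥
      disconnected = true⇒≢false (closed-walk (TT.connected {ι zero u₀} {ι (next zero) u₁} refl refl)
                                              (imageᵥ⁺ (ι zero) (minus-true u₀≢c)))
                                 (outside (next≢ zero) u₁≢c)

    no-isolated-x : ∀ i → ¬ Isolated i (x i)
    no-isolated-x i iso = Separated.disconnected x (x-isolation-everywhere i iso) outside
                            (y zero) (Fr.x≢y zero ∘ sym) (y (next zero)) (Fr.x≢y (next zero) ∘ sym)
      where
      outside : ∀ {l u} → l ≢ zero → u ≢ x l → imageᵥ (ι zero) (minus (x zero)) (ι l u) ≡ false
      outside {l} {u} l≢0 u≢x = ¬true⇒false λ e → case (imageᵥ⁻ (ι zero) e)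
        where
        case : (∃ λ u' → minus (x zero) u' ≡ true × ι zero u' ≡ ι l u) → ⊥
        case (u' , Su' , e) with ι-cross zero l e (l≢0 ∘ sym)
        ... | inj₁ (_ , _ , u≡x) = u≢x u≡x
        ... | inj₂ (refl , _ , _) = minus-true⁻ {z = x zero} Su' refl

    no-isolated-y : ∀ i → ¬ Isolated i (y i)
    no-isolated-y i iso = Separated.disconnected y (y-isolation-everywhere i iso) outside
                            (x zero) (Fr.x≢y zero) (x (next zero)) (Fr.x≢y (next zero))
      where
      outside : ∀ {l u} → l ≢ zero → u ≢ y l → imageᵥ (ι zero) (minus (y zero)) (ι l u) ≡ false
      outside {l} {u} l≢0 u≢y = ¬true⇒false λ e → case (imageᵥ⁻ (ι zero) e)
        where
        case : (∃ λ u' → minus (y zero) u' ≡ true × ι zero u' ≡ ι l u) → ⊥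
        case (u' , Su' , e) with ι-cross zero l e (l≢0 ∘ sym)
        ... | inj₁ (refl , _ , _) = minus-true⁻ {z = y zero} Su' refl
        ... | inj₂ (_ , _ , u≡y) = u≢y u≡y

    -- The x₀–y₀ path leaves x₀ for the last time along an edge x₀a; from a it reaches y₀ without
    -- x₀ and then returns to x₀ through the other fragments, so x₀a lies on a cycle of T.

    module Linked (linked : ∀ i → Conn (R i) (x i) (y i)) where

      private
        s : Fin K
        s = zero

        exit : ∃ λ a → Edge (R s) (x s) a × Conn (avoiding (R s) (x s)) a (y s)
        exit = last-exit (R s) (linked s) (Fr.x≢y s)

        a : Fin (n s)
        a = proj₁ exit

        z za : Fin N
        z = ι s (x s)
        za = ι s a

        D : EdgeSet N
        D = deleteEdge T z za

        first-leg : Conn D za (ι s (y s))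
        first-leg = Star.gmap (ι s) step (proj₂ (proj₂ exit))
          where
          step : ∀ {c d} → Edge (avoiding (R s) (x s)) c d → Edge D (ι s c) (ι s d)
          step {c} {d} e = deleteEdge⁺ {T = T} (R→T s (∧-conicalˡ _ _ e))
            (λ (p , _) → minus-true⁻ (∧-conicalˡ _ _ (∧-conicalʳ (R s c d) _ e)) (ι-injective s p))
            (λ (_ , q) → minus-true⁻ (∧-conicalʳ (minus (x s) c) _ (∧-conicalʳ (R s c d) _ e)) (ι-injective s q))

        x-or-y : ∀ {l} → l ≢ s → ∀ {c u} → ι l c ≡ ι s u → c ≡ x l ⊎ c ≡ y l
        x-or-y l≢s e with ι-cross _ s e l≢s
        ... | inj₁ (c≡y , _) = inj₂ c≡y
        ... | inj₂ (c≡x , _) = inj₁ c≡x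

        -- an edge of R_l between two vertices shared with H_s would be the edge x_l y_l
        leg : ∀ l → l ≢ s → Conn D (ι l (x l)) (ι l (y l))
        leg l l≢s = Star.gmap (ι l) step (linked l)
          where
          no-xy : ¬ Edge (R l) (x l) (y l)
          no-xy = RF.linked⇒no-xy l (linked l)
          shared : ∀ {c d u w} → Edge (R l) c d → ι l c ≡ ι s u → ι l d ≡ ι s w → ⊥
          shared e p q with x-or-y l≢s p | x-or-y l≢s q
          ... | inj₁ refl | inj₁ refl = R-no-loop l e
          ... | inj₂ refl | inj₂ refl = R-no-loop l e
          ... | inj₁ refl | inj₂ refl = no-xy e
          ... | inj₂ refl | inj₁ refl = no-xy (edge-sym (proj₁ (R-forest l)) e)
          step : ∀ {c d} → Edge (R l) c d → Edge D (ι l c) (ι l d)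
          step e = deleteEdge⁺ {T = T} (R→T l e) (λ (p , q) → shared e p q) (λ (p , q) → shared e p q)

        around : ∀ t → suc t ≤ K → Conn D (ι (next s) (x (next s))) (ι (rot s (suc t)) (x (rot s (suc t))))
        around zero _ = ε
        around (suc t) t+2≤K = around t (<⇒≤ t+2≤K) ◅◅ walk-subst refl (junction i) (leg i i≢s)
          where
          i : Fin K
          i = rot s (suc t)
          i≢s : i ≢ s
          i≢s e with rot-injective s (s≤s z≤n) (<⇒≤ t+2≤K) (sym e)
          ... | _ , t+1≡K = 1+n≰n (subst (λ b → suc b ≤ K) t+1≡K t+2≤K)

        closing : Conn D (ι s (y s)) z
        closing = walk-subst (sym (junction s)) (cong (λ j → ι j (x j)) (rot-K s)) (around (suc m) ≤-refl)

      cycle : ⊥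
      cycle = TT.acyclic z za (R→T s (proj₁ (proj₂ exit)))
                (walk-reverse (deleteEdge-undirected {T = T} {z} {za} TT.undirected) (first-leg ◅◅ closing))

    contradiction : ⊥
    contradiction with some-isolated-or-all-attached x | some-isolated-or-all-attached y
    ... | inj₁ (i , iso) | _ = no-isolated-x i iso
    ... | inj₂ _ | inj₁ (i , iso) = no-isolated-y i iso
    ... | inj₂ x-attached | inj₂ y-attached =
      ¬¬-∀-Fin (λ i → RF.attached⇒¬¬linked i (x-attached i) (y-attached i)) Linked.cycle

theorem1 : (k : ℕ) → 2 ≤ k →
    (n : Fin k → ℕ) (H : (i : Fin k) → Graph (n i))
    (x y : (i : Fin k) → Fin (n i)) →
    (∀ i → IsHISTCriticalFragment (H i) (x i) (y i)) →
    (N : ℕ) (G : Graph N) (φ : Σ (Fin k) (λ i → Fin (n i)) → Fin N) →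
    IsCyclicGluing n H x y G φ →
    IsHISTCritical G
theorem1 (suc (suc m)) (s≤s (s≤s z≤n)) n H x y frag N G φ gluing =
  (λ (T , hist) → Gluing.NoHIST.contradiction m n H x y frag N G φ gluing T hist) ,
  Gluing.removal m n H x y frag N G φ gluing
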